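{- For all integers $n\ge0$ and $k\ge1$, $\dim_{\mathbb{Q}}\rho_n(\check{\mathfrak{H}}_k^1)=\#Y_{n+k,n}-2$.
   Context: Let $\mathfrak{H}=\mathbb{Q}\langle x,y\rangle$ be the noncommutative polynomial algebra over $\mathbb{Q}$ in $x,y$; $z=x+y$, $z_k=x^{k-1}y$. For $k\ge1$, $\check{\mathfrak{H}}_k^1$ is the $\mathbb{Q}$-span of all monomials $z_{k_1}\cdots z_{k_l}$ with $l\ge1$, $k_i\ge1$, $k_1+\dots+k_l=k$, not all $k_i=1$. For $n\ge0$, make $\mathfrak{H}^{\otimes(n+2)}$ an $\mathfrak{H}$-bimodule via $a\diamond(w_1\otimes\cdots\otimes w_{n+2})\diamond b=w_1b\otimes w_2\otimes\cdots\otimes w_{n+1}\otimes aw_{n+2}$. Let $\mathcal{C}_n\colon\mathfrak{H}\to\mathfrak{H}^{\otimes(n+2)}$ be the $\mathbb{Q}$-linear map with $\mathcal{C}_n(1)=0$, $\mathcal{C}_n(x)=x\otimes z^{\otimes n}\otimes y$, $\mathcal{C}_n(y)=-x\otimes z^{\otimes n}\otimes y$, $\mathcal{C}_n(ww')=\mathcal{C}_n(w)\diamond w'+w\diamond\mathcal{C}_n(w')$; $M_n(w_1\otimes\cdots\otimes w_{n+2})=w_1\cdots w_{n+2}$; $\rho_n=M_n\circ\mathcal{C}_n$. For $l\ge1$, $X_l=\{y,z\}^l$ (tuples of the symbols $y,z$) with $\mathbb{Z}/l\mathbb{Z}$ acting by cyclic shifts $j(u_1,\dots,u_l)=(u_{j+1},\dots,u_{j+l})$.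 For $n\in\{0,\dots,l\}$, $X_{l,n}\subset X_l$ is the set of tuples containing at least $n$ consecutive $z$'s when read cyclically, and $Y_{l,n}=X_{l,n}/(\mathbb{Z}/l\mathbb{Z})$ is its set of cyclic equivalence classes (equivalently, the classes of tuples of the form $(z,\dots,z,u_{n+1},\dots,u_l)$ with $n$ leading $z$'s). -}

module Defs where

open import Data.Nat using (ℕ; zero; suc; _+_; _∸_; _≤_; _<_)
open import Data.Fin using (Fin; toℕ)
open import Data.Rational using (ℚ; 0ℚ; 1ℚ; -_) renaming (_+_ to _+ℚ_; _*_ to _*ℚ_)
open import Data.List using (List; []; _∷_; _++_; map; concat; concatMap; replicate; length)
open import Data.Nat.ListAction using (sum)
open import Data.List.Relation.Unary.All using (All)
open import Data.List.Relation.Unary.Any using (Any)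
open import Data.List.Relation.Unary.AllPairs using (AllPairs)
open import Data.List.Properties using (≡-dec)
open import Data.Vec using (Vec; _∷ʳ_; lookup; toList) renaming ([] to []ᵥ; _∷_ to _∷ᵥ_)
open import Data.Product using (Σ; ∃; _×_; _,_)
open import Relation.Binary.PropositionalEquality using (_≡_; _≢_; refl)
open import Relation.Nullary using (¬_; Dec; yes; no)
open import Function using (_∘_)

-- The algebra 𝔥 = ℚ⟨x,y⟩ : formal finite ℚ-linear combinations of words,
-- compared extensionally by coefficients.

data Letter : Set where
  x y : Letter

_≟L_ : (a b : Letter) → Dec (a ≡ b)
x ≟L x = yes refl
x ≟L y = no λ ()
y ≟L x = no λ ()
y ≟L y = yes refl

Word : Set
Word = List Letter

_≟W_ : (u v : Word) → Dec (u ≡ v)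
_≟W_ = ≡-dec _≟L_

Poly : Set
Poly = List (ℚ × Word)

coeff : Poly → Word → ℚ
coeff [] w = 0ℚ
coeff ((c , u) ∷ p) w with u ≟W w
... | yes _ = c +ℚ coeff p w
... | no _  = coeff p w

_≈ₚ_ : Poly → Poly → Set
p ≈ₚ q = ∀ w → coeff p w ≡ coeff q w

scale : ℚ → Poly → Poly
scale c = map (λ { (a , w) → (c *ℚ a , w) })

zeroP : Poly
zeroP = []

lincomb : {d : ℕ} → Vec ℚ d → Vec Poly d → Poly
lincomb []ᵥ []ᵥ = []
lincomb (c ∷ᵥ cs) (b ∷ᵥ bs) = scale c b ++ lincomb cs bs

-- 𝔥^{⊗(n+2)} : formal ℚ-combinations of pure tensors of words
-- w₁ ⊗ (w₂ ⊗ ⋯ ⊗ w_{n+1}) ⊗ w_{n+2}, stored as (w₁ , middle , w_{n+2}).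

Tens : ℕ → Set
Tens n = List (ℚ × (Word × Vec Word n × Word))

-- the pure tensors whose sum is z^{⊗n}, z = x + y
zTensors : (n : ℕ) → List (Vec Word n)
zTensors zero = []ᵥ ∷ []
zTensors (suc n) = concatMap (λ m → ((x ∷ []) ∷ᵥ m) ∷ ((y ∷ []) ∷ᵥ m) ∷ []) (zTensors n)

-- right action  (w₁ ⊗ ⋯ ⊗ w_{n+2}) ⋄ b = w₁ b ⊗ ⋯
actR : {n : ℕ} → Word → ℚ × (Word × Vec Word n × Word) → ℚ × (Word × Vec Word n × Word)
actR b (c , (f , m , l)) = (c , (f ++ b , m , l))

-- left action  a ⋄ (w₁ ⊗ ⋯ ⊗ w_{n+2}) = ⋯ ⊗ a w_{n+2}
actL : {n : ℕ} → Word → ℚ × (Word × Vec Word n × Word) → ℚ × (Word × Vec Word n × Word)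
actL a (c , (f , m , l)) = (c , (f , m , a ++ l))

Cletter : (n : ℕ) → Letter → Tens n
Cletter n x = map (λ m → (1ℚ , (x ∷ [] , m , y ∷ []))) (zTensors n)
Cletter n y = map (λ m → (- 1ℚ , (x ∷ [] , m , y ∷ []))) (zTensors n)

-- 𝒞ₙ on words, via 𝒞ₙ(1) = 0 and 𝒞ₙ(a w) = 𝒞ₙ(a) ⋄ w + a ⋄ 𝒞ₙ(w)
Cword : (n : ℕ) → Word → Tens n
Cword n [] = []
Cword n (a ∷ w) = map (actR w) (Cletter n a) ++ map (actL (a ∷ [])) (Cword n w)

Cn : (n : ℕ) → Poly → Tens n
Cn n = concatMap (λ { (c , w) → map (λ { (d , t) → (c *ℚ d , t) }) (Cword n w) })

Mn : (n : ℕ) → Tens n → Poly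
Mn n = map (λ { (c , (f , m , l)) → (c , f ++ concat (toList m) ++ l) })

ρ : (n : ℕ) → Poly → Poly
ρ n p = Mn n (Cn n p)

-- Ȟ¹ₖ : span of z_{k₁}⋯z_{kₗ}, l ≥ 1, kᵢ ≥ 1, Σ kᵢ = k, not all kᵢ = 1

zk : ℕ → Word
zk k = replicate (k ∸ 1) x ++ (y ∷ [])

AdmMono : ℕ → Word → Set
AdmMono k w = Σ (List ℕ) λ ks →
  (ks ≢ []) × All (1 ≤_) ks × (sum ks ≡ k) × Any (2 ≤_) ks × (w ≡ concatMap zk ks)

InHcheck : ℕ → Poly → Set
InHcheck k p = All (λ { (c , w) → AdmMono k w }) p

ImRho : ℕ → ℕ → Poly → Set
ImRho n k q = Σ Poly λ p → InHcheck k p × (q ≈ₚ ρ n p)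

HasDim : (Poly → Set) → ℕ → Set
HasDim V d = Σ (Vec Poly d) λ b →
  (∀ i → V (lookup b i)) ×
  (∀ (c : Vec ℚ d) → lincomb c b ≈ₚ zeroP → ∀ i → lookup c i ≡ 0ℚ) ×
  (∀ q → V q → Σ (Vec ℚ d) λ c → q ≈ₚ lincomb c b)

data Sym : Set where
  sy sz : Sym

rot1 : {A : Set} {l : ℕ} → Vec A l → Vec A l
rot1 []ᵥ = []ᵥ
rot1 (a ∷ᵥ as) = as ∷ʳ a

rot : {A : Set} {l : ℕ} → ℕ → Vec A l → Vec A l
rot zero u = u
rot (suc j) u = rot j (rot1 u)

CycEq : {l : ℕ} → Vec Sym l → Vec Sym l → Set
CycEq u v = ∃ λ j → rot j u ≡ v

InX : (l n : ℕ) → Vec Sym l → Set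
InX l n u = ∃ λ j → ∀ (i : Fin l) → toℕ i < n → lookup (rot j u) i ≡ sz

-- #Y_{l,n} = m : R is a list of representatives of the cyclic classes of X_{l,n}
OrbitReps : (l n : ℕ) → List (Vec Sym l) → Set
OrbitReps l n R =
  All (InX l n) R ×
  (∀ u → InX l n u → Any (CycEq u) R) ×
  AllPairs (λ u v → ¬ CycEq u v) R

NumY : (l n m : ℕ) → Set
NumY l n m = Σ (List (Vec Sym l)) λ R → OrbitReps l n R × length R ≡ m

module Submission where

-- Rewrite polynomials in the basis of {y,z}-monomials via x = z - y. Since
-- ρₙ(w) = Σ_{w = p a q} ± x q zⁿ p y, the coefficient of ρₙ(P) at z V y is, up to sign,
-- Σ_u c_u · #{i ≤ n + k : rotating y V by i gives u zⁿ}, where the c_u are the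
-- {y,z}-coefficients of P. Hence ρₙ(P) only depends on the sums of the c_u over the
-- cyclic classes of the tuples u zⁿ, that is over Y_{n+k,n}. For P in Ȟ¹ₖ two of these
-- sums are redundant: monomials containing y have no coefficient at zᵏ, and the
-- coefficients of a monomial containing x add up to 0, which determines the sum for the
-- class of y z^{n+k-1}. Each remaining class contains a tuple a y zⁿ with y in a; choosing
-- one a per class, the images of the expansions of a y minus those of z^{k-1} y (both
-- without yᵏ) form a basis, since the coefficient at z zⁿ a y only sees the vector of a.

open import Data.Nat using (ℕ)

module Sums where

  open import Data.Nat using (ℕ; zero; suc; _<_; s≤s) renaming (_+_ to _+ℕ_)
  import Data.Nat.Properties as ℕP
  open import Data.Rational using (ℚ; 0ℚ; 1ℚ; -_; _+_; _*_; _≤_)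
  import Data.Rational.Properties as ℚP
  open import Data.Rational.Solver using (module +-*-Solver)
  open import Data.List using (List; []; _∷_; _++_; map; concatMap)
  open import Data.List.Relation.Unary.All using (All; []; _∷_)
  open import Data.Sum using (inj₁; inj₂)
  open import Relation.Binary.PropositionalEquality
  open +-*-Solver

  ∑ : {A : Set} → List A → (A → ℚ) → ℚ
  ∑ [] f = 0ℚ
  ∑ (a ∷ as) f = f a + ∑ as f

  ∑< : ℕ → (ℕ → ℚ) → ℚ
  ∑< zero f = 0ℚ
  ∑< (suc N) f = ∑< N f + f N

  module _ {A : Set} where

    ∑-++ : (l m : List A) (f : A → ℚ) → ∑ (l ++ m) f ≡ ∑ l f + ∑ m f
    ∑-++ [] m f = sym (ℚP.+-identityˡ _)
    ∑-++ (a ∷ l) m f = trans (cong (f a +_) (∑-++ l m f)) (sym (ℚP.+-assoc (f a) _ _))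

    ∑-cong : (l : List A) {f g : A → ℚ} → (∀ a → f a ≡ g a) → ∑ l f ≡ ∑ l g
    ∑-cong [] e = refl
    ∑-cong (a ∷ l) e = cong₂ _+_ (e a) (∑-cong l e)

    ∑-congᴬ : {P : A → Set} (l : List A) {f g : A → ℚ} → All P l → (∀ a → P a → f a ≡ g a) → ∑ l f ≡ ∑ l g
    ∑-congᴬ [] _ e = refl
    ∑-congᴬ (a ∷ l) (pa ∷ ps) e = cong₂ _+_ (e a pa) (∑-congᴬ l ps e)

    ∑-+ : (l : List A) (f g : A → ℚ) → ∑ l (λ a → f a + g a) ≡ ∑ l f + ∑ l g
    ∑-+ [] f g = sym (ℚP.+-identityˡ _)
    ∑-+ (a ∷ l) f g = trans (cong (f a + g a +_) (∑-+ l f g))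
      (solve 4 (λ p q r s → (p :+ q) :+ (r :+ s) := (p :+ r) :+ (q :+ s)) refl (f a) (g a) (∑ l f) (∑ l g))

    ∑-* : (l : List A) (c : ℚ) (f : A → ℚ) → ∑ l (λ a → c * f a) ≡ c * ∑ l f
    ∑-* [] c f = sym (ℚP.*-zeroʳ c)
    ∑-* (a ∷ l) c f = trans (cong (c * f a +_) (∑-* l c f)) (sym (ℚP.*-distribˡ-+ c (f a) _))

    ∑-neg : (l : List A) (f : A → ℚ) → ∑ l (λ a → - f a) ≡ - ∑ l f
    ∑-neg l f = trans (∑-cong l (λ a → solve 1 (λ p → :- p := (:- con 1ℚ) :* p) refl (f a)))
      (trans (∑-* l (- 1ℚ) f) (solve 1 (λ p → (:- con 1ℚ) :* p := :- p) refl (∑ l f)))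

    ∑-zero : (l : List A) (f : A → ℚ) → (∀ a → f a ≡ 0ℚ) → ∑ l f ≡ 0ℚ
    ∑-zero l f e = trans (∑-cong l e) (zeros l)
      where
      zeros : (l : List A) → ∑ l (λ _ → 0ℚ) ≡ 0ℚ
      zeros [] = refl
      zeros (a ∷ l) = trans (ℚP.+-identityˡ _) (zeros l)

  ∑-zeroᴬ : {A : Set} {P : A → Set} (l : List A) (f : A → ℚ) → All P l → (∀ a → P a → f a ≡ 0ℚ) → ∑ l f ≡ 0ℚ
  ∑-zeroᴬ l f ps e = trans (∑-congᴬ l ps e) (∑-zero l (λ _ → 0ℚ) (λ _ → refl))

  ∑-map : {A B : Set} (g : A → B) (l : List A) (f : B → ℚ) → ∑ (map g l) f ≡ ∑ l (λ a → f (g a))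
  ∑-map g [] f = refl
  ∑-map g (a ∷ l) f = cong (f (g a) +_) (∑-map g l f)

  ∑-concatMap : {A B : Set} (g : A → List B) (l : List A) (f : B → ℚ) →
    ∑ (concatMap g l) f ≡ ∑ l (λ a → ∑ (g a) f)
  ∑-concatMap g [] f = refl
  ∑-concatMap g (a ∷ l) f = trans (∑-++ (g a) (concatMap g l) f) (cong (∑ (g a) f +_) (∑-concatMap g l f))

  ∑-swap : {A B : Set} (l : List A) (m : List B) (f : A → B → ℚ) →
    ∑ l (λ a → ∑ m (f a)) ≡ ∑ m (λ b → ∑ l (λ a → f a b))
  ∑-swap [] m f = sym (∑-zero m _ (λ _ → refl))
  ∑-swap (a ∷ l) m f = trans (cong (∑ m (f a) +_) (∑-swap l m f)) (sym (∑-+ m (f a) _))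

  ∑<-cong : (N : ℕ) {f g : ℕ → ℚ} → (∀ i → i < N → f i ≡ g i) → ∑< N f ≡ ∑< N g
  ∑<-cong zero e = refl
  ∑<-cong (suc N) e = cong₂ _+_ (∑<-cong N (λ i p → e i (ℕP.m<n⇒m<1+n p))) (e N ℕP.≤-refl)

  ∑<-+ : (N : ℕ) (f g : ℕ → ℚ) → ∑< N (λ a → f a + g a) ≡ ∑< N f + ∑< N g
  ∑<-+ zero f g = refl
  ∑<-+ (suc N) f g = trans (cong (_+ (f N + g N)) (∑<-+ N f g))
    (solve 4 (λ p q r s → (p :+ q) :+ (r :+ s) := (p :+ r) :+ (q :+ s)) refl (∑< N f) (∑< N g) (f N) (g N))

  ∑<-* : (N : ℕ) (c : ℚ) (f : ℕ → ℚ) → ∑< N (λ a → c * f a) ≡ c * ∑< N f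
  ∑<-* zero c f = sym (ℚP.*-zeroʳ c)
  ∑<-* (suc N) c f = trans (cong (_+ c * f N) (∑<-* N c f)) (sym (ℚP.*-distribˡ-+ c _ (f N)))

  ∑<-zero : (N : ℕ) (f : ℕ → ℚ) → (∀ i → i < N → f i ≡ 0ℚ) → ∑< N f ≡ 0ℚ
  ∑<-zero N f e = trans (∑<-cong N e) (zeros N)
    where
    zeros : (M : ℕ) → ∑< M (λ _ → 0ℚ) ≡ 0ℚ
    zeros zero = refl
    zeros (suc M) = trans (ℚP.+-identityʳ _) (zeros M)

  ∑<-+ℕ : (a b : ℕ) (f : ℕ → ℚ) → ∑< (a +ℕ b) f ≡ ∑< a f + ∑< b (λ m → f (a +ℕ m))
  ∑<-+ℕ a zero f = trans (cong (λ m → ∑< m f) (ℕP.+-identityʳ a)) (sym (ℚP.+-identityʳ _))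
  ∑<-+ℕ a (suc b) f = begin
    ∑< (a +ℕ suc b) f                               ≡⟨ cong (λ m → ∑< m f) (ℕP.+-suc a b) ⟩
    ∑< (a +ℕ b) f + f (a +ℕ b)                      ≡⟨ cong (_+ f (a +ℕ b)) (∑<-+ℕ a b f) ⟩
    ∑< a f + ∑< b (λ m → f (a +ℕ m)) + f (a +ℕ b)   ≡⟨ ℚP.+-assoc (∑< a f) _ _ ⟩
    ∑< a f + ∑< (suc b) (λ m → f (a +ℕ m))          ∎
    where open ≡-Reasoning

  ∑<-shift : (N : ℕ) (f : ℕ → ℚ) → ∑< N (λ i → f (suc i)) + f zero ≡ ∑< N f + f N
  ∑<-shift zero f = refl
  ∑<-shift (suc N) f = begin
    ∑< N (λ i → f (suc i)) + f (suc N) + f zero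
      ≡⟨ solve 3 (λ p q r → (p :+ q) :+ r := (p :+ r) :+ q) refl (∑< N (λ i → f (suc i))) (f (suc N)) (f zero) ⟩
    ∑< N (λ i → f (suc i)) + f zero + f (suc N)
      ≡⟨ cong (_+ f (suc N)) (∑<-shift N f) ⟩
    ∑< (suc N) f + f (suc N)
      ∎
    where open ≡-Reasoning

  ∑-∑<-swap : {A : Set} (l : List A) (N : ℕ) (f : A → ℕ → ℚ) →
    ∑ l (λ a → ∑< N (f a)) ≡ ∑< N (λ i → ∑ l (λ a → f a i))
  ∑-∑<-swap [] N f = sym (∑<-zero N _ (λ _ _ → refl))
  ∑-∑<-swap (a ∷ l) N f = trans (cong (∑< N (f a) +_) (∑-∑<-swap l N f)) (sym (∑<-+ N (f a) _))

  ∑<-≥-term : (N : ℕ) (f : ℕ → ℚ) → (∀ i → 0ℚ ≤ f i) → (j : ℕ) → j < N → f j ≤ ∑< N f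
  ∑<-≥-term (suc N) f nonneg j (s≤s j≤N) with ℕP.m≤n⇒m<n∨m≡n j≤N
  ... | inj₁ j<N = subst (_≤ ∑< N f + f N) (ℚP.+-identityʳ (f j)) (ℚP.+-mono-≤ (∑<-≥-term N f nonneg j j<N) (nonneg N))
  ... | inj₂ refl = subst (_≤ ∑< N f + f j) (ℚP.+-identityˡ (f j)) (ℚP.+-mono-≤ (∑<-nonneg N) ℚP.≤-refl)
    where
    ∑<-nonneg : (M : ℕ) → 0ℚ ≤ ∑< M f
    ∑<-nonneg zero = ℚP.≤-refl
    ∑<-nonneg (suc M) = subst (_≤ ∑< M f + f M) (ℚP.+-identityʳ 0ℚ) (ℚP.+-mono-≤ (∑<-nonneg M) (nonneg M))

module Lists where

  open import Data.Nat using (ℕ; zero; suc; _+_)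
  import Data.Nat.Properties as ℕP
  open import Data.List using (List; []; _∷_; _++_; length; take; drop)
  import Data.List.Properties as LP
  open import Data.Product using (Σ; _×_; _,_)
  open import Data.Nat.Solver using (module +-*-Solver)
  open import Relation.Binary.PropositionalEquality
  open +-*-Solver

  module _ {A : Set} where

    take-++-exact : (xs ys : List A) {n : ℕ} → length xs ≡ n → take n (xs ++ ys) ≡ xs
    take-++-exact [] ys refl = refl
    take-++-exact (a ∷ xs) ys refl = cong (a ∷_) (take-++-exact xs ys refl)

    drop-++-exact : (xs ys : List A) {n : ℕ} → length xs ≡ n → drop n (xs ++ ys) ≡ ys
    drop-++-exact [] ys refl = refl
    drop-++-exact (a ∷ xs) ys refl = drop-++-exact xs ys refl

    splitAt-length : (xs : List A) (m r : ℕ) → length xs ≡ m + r →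
      Σ (List A) λ ys → Σ (List A) λ zs → (xs ≡ ys ++ zs) × (length ys ≡ m) × (length zs ≡ r)
    splitAt-length xs zero r e = [] , xs , refl , refl , e
    splitAt-length [] (suc m) r ()
    splitAt-length (a ∷ xs) (suc m) r e with splitAt-length xs m r (ℕP.suc-injective e)
    ... | ys , zs , refl , eys , ezs = a ∷ ys , zs , refl , cong suc eys , ezs

    length-∷ʳ : (xs : List A) (a : A) → length (xs ++ a ∷ []) ≡ suc (length xs)
    length-∷ʳ xs a = trans (LP.length-++ xs) (ℕP.+-comm (length xs) 1)

    length-split : (p : List A) (a : A) (q : List A) (n : ℕ) →
      length (p ++ a ∷ q) + n ≡ suc (length q + (n + length p))
    length-split p a q n = trans (cong (_+ n) (LP.length-++ p))
      (solve 3 (λ lp lq m → (lp :+ (con 1 :+ lq)) :+ m := con 1 :+ (lq :+ (m :+ lp))) refl (length p) (length q) n)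

module ChangeOfBasis where

  open import Defs
  open Sums
  open Lists
  open import Data.Nat using (ℕ; zero; suc)
  import Data.Nat.Properties as ℕP
  open import Data.Rational using (ℚ; 0ℚ; 1ℚ; -_; _+_; _*_)
  import Data.Rational.Properties as ℚP
  open import Data.Rational.Solver using (module +-*-Solver)
  open import Data.List using (List; []; _∷_; _++_; map; length; take; drop)
  import Data.List.Properties as LP
  open import Data.Product using (_,_; proj₁; proj₂)
  open import Data.Empty using (⊥-elim)
  open import Relation.Nullary using (¬_; Dec; yes; no)
  open import Relation.Binary.PropositionalEquality
  open +-*-Solver

  yzCoeffˡ : Letter → Sym → ℚ
  yzCoeffˡ x sz = 1ℚ
  yzCoeffˡ x sy = - 1ℚ
  yzCoeffˡ y sz = 0ℚ
  yzCoeffˡ y sy = 1ℚ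

  -- Substituting x = z - y, yzCoeff w T is the coefficient of the {y,z}-monomial T in w.
  yzCoeff : Word → List Sym → ℚ
  yzCoeff [] [] = 1ℚ
  yzCoeff [] (_ ∷ _) = 0ℚ
  yzCoeff (_ ∷ _) [] = 0ℚ
  yzCoeff (a ∷ w) (s ∷ T) = yzCoeffˡ a s * yzCoeff w T

  yzCoeff-length : (w : Word) (T : List Sym) → ¬ (length w ≡ length T) → yzCoeff w T ≡ 0ℚ
  yzCoeff-length [] [] ne = ⊥-elim (ne refl)
  yzCoeff-length [] (_ ∷ _) ne = refl
  yzCoeff-length (_ ∷ _) [] ne = refl
  yzCoeff-length (a ∷ w) (s ∷ T) ne =
    trans (cong (yzCoeffˡ a s *_) (yzCoeff-length w T (λ e → ne (cong suc e)))) (ℚP.*-zeroʳ (yzCoeffˡ a s))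

  yzCoeff-++ : (p q : Word) (T : List Sym) →
    yzCoeff (p ++ q) T ≡ yzCoeff p (take (length p) T) * yzCoeff q (drop (length p) T)
  yzCoeff-++ [] q T = sym (ℚP.*-identityˡ _)
  yzCoeff-++ (a ∷ p) [] [] = sym (ℚP.*-zeroˡ 1ℚ)
  yzCoeff-++ (a ∷ p) (b ∷ q) [] = sym (ℚP.*-zeroˡ 0ℚ)
  yzCoeff-++ (a ∷ p) q (s ∷ T) =
    trans (cong (yzCoeffˡ a s *_) (yzCoeff-++ p q T)) (sym (ℚP.*-assoc (yzCoeffˡ a s) _ _))

  yzCoeff-++-exact : (p q : Word) (V W : List Sym) → length p ≡ length V →
    yzCoeff (p ++ q) (V ++ W) ≡ yzCoeff p V * yzCoeff q W
  yzCoeff-++-exact p q V W e = trans (yzCoeff-++ p q (V ++ W))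
    (cong₂ (λ A B → yzCoeff p A * yzCoeff q B) (take-++-exact V W (sym e)) (drop-++-exact V W (sym e)))

  yzCoeff-∷ʳ : (p : Word) (a : Letter) (V : List Sym) (s : Sym) →
    yzCoeff (p ++ a ∷ []) (V ++ s ∷ []) ≡ yzCoeff p V * yzCoeffˡ a s
  yzCoeff-∷ʳ p a V s with length p ℕP.≟ length V
  ... | yes e = trans (yzCoeff-++-exact p (a ∷ []) V (s ∷ []) e) (cong (yzCoeff p V *_) (ℚP.*-identityʳ (yzCoeffˡ a s)))
  ... | no ne = trans (yzCoeff-length (p ++ a ∷ []) (V ++ s ∷ []) ne′)
                  (sym (trans (cong (_* yzCoeffˡ a s) (yzCoeff-length p V ne)) (ℚP.*-zeroˡ (yzCoeffˡ a s))))
    where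
    ne′ : ¬ (length (p ++ a ∷ []) ≡ length (V ++ s ∷ []))
    ne′ e = ne (ℕP.suc-injective (trans (sym (length-∷ʳ p a)) (trans e (length-∷ʳ V s))))

  _≟S_ : (a b : Sym) → Dec (a ≡ b)
  sy ≟S sy = yes refl
  sy ≟S sz = no (λ ())
  sz ≟S sy = no (λ ())
  sz ≟S sz = yes refl

  _≟Ss_ : (u v : List Sym) → Dec (u ≡ v)
  _≟Ss_ = LP.≡-dec _≟S_

  χ : {P : Set} → Dec P → ℚ
  χ (yes _) = 1ℚ
  χ (no _) = 0ℚ

  χ-yes : {P : Set} (d : Dec P) → P → χ d ≡ 1ℚ
  χ-yes (yes _) _ = refl
  χ-yes (no ¬p) p = ⊥-elim (¬p p)

  χ-no : {P : Set} (d : Dec P) → ¬ P → χ d ≡ 0ℚ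
  χ-no (yes p) ¬p = ⊥-elim (¬p p)
  χ-no (no _) _ = refl

  χˢ : List Sym → List Sym → ℚ
  χˢ u v = χ (u ≟Ss v)

  χʷ : Word → Word → ℚ
  χʷ u v = χ (u ≟W v)

  χˢ-refl : (u : List Sym) → χˢ u u ≡ 1ℚ
  χˢ-refl u = χ-yes (u ≟Ss u) refl

  χʷ-refl : (u : Word) → χʷ u u ≡ 1ℚ
  χʷ-refl u = χ-yes (u ≟W u) refl

  χ-⇔ : {P Q : Set} (p : Dec P) (q : Dec Q) → (P → Q) → (Q → P) → χ p ≡ χ q
  χ-⇔ (yes _) (yes _) _ _ = refl
  χ-⇔ (no _) (no _) _ _ = refl
  χ-⇔ (yes p) (no ¬q) f _ = ⊥-elim (¬q (f p))
  χ-⇔ (no ¬p) (yes q) _ g = ⊥-elim (¬p (g q))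

  χˢ-∷ : (a : Sym) (u v : List Sym) → χˢ (a ∷ u) (a ∷ v) ≡ χˢ u v
  χˢ-∷ a u v = χ-⇔ (_ ≟Ss _) (u ≟Ss v) LP.∷-injectiveʳ (cong (a ∷_))

  χˢ-∷-≢ : {a b : Sym} (u v : List Sym) → ¬ (a ≡ b) → χˢ (a ∷ u) (b ∷ v) ≡ 0ℚ
  χˢ-∷-≢ u v ne = χ-no (_ ≟Ss _) (λ e → ne (LP.∷-injectiveˡ e))

  χʷ-∷ : (a : Letter) (u v : Word) → χʷ (a ∷ u) (a ∷ v) ≡ χʷ u v
  χʷ-∷ a u v = χ-⇔ (_ ≟W _) (u ≟W v) LP.∷-injectiveʳ (cong (a ∷_))

  χˢ-∷∷ : (a b : Sym) (u v : List Sym) → χˢ (a ∷ u) (b ∷ v) ≡ χ (a ≟S b) * χˢ u v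
  χˢ-∷∷ a b u v = cases (a ≟S b)
    where
    cases : (d : Dec (a ≡ b)) → χˢ (a ∷ u) (b ∷ v) ≡ χ d * χˢ u v
    cases (yes refl) = trans (χˢ-∷ a u v) (sym (ℚP.*-identityˡ (χˢ u v)))
    cases (no ne) = trans (χˢ-∷-≢ u v ne) (sym (ℚP.*-zeroˡ (χˢ u v)))

  χʷ-∷∷ : (a b : Letter) (u v : Word) → χʷ (a ∷ u) (b ∷ v) ≡ χ (a ≟L b) * χʷ u v
  χʷ-∷∷ a b u v = cases (a ≟L b)
    where
    cases : (d : Dec (a ≡ b)) → χʷ (a ∷ u) (b ∷ v) ≡ χ d * χʷ u v
    cases (yes refl) = trans (χʷ-∷ a u v) (sym (ℚP.*-identityˡ (χʷ u v)))
    cases (no ne) = trans (χ-no (_ ≟W _) (λ e → ne (LP.∷-injectiveˡ e))) (sym (ℚP.*-zeroˡ (χʷ u v)))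

  χˢ-++ : (u z A B : List Sym) → length u ≡ length A → χˢ u A * χˢ z B ≡ χˢ (u ++ z) (A ++ B)
  χˢ-++ u z A B e = cases (u ≟Ss A) (z ≟Ss B)
    where
    cases : Dec (u ≡ A) → Dec (z ≡ B) → χˢ u A * χˢ z B ≡ χˢ (u ++ z) (A ++ B)
    cases (yes refl) (yes refl) =
      trans (cong₂ _*_ (χˢ-refl u) (χˢ-refl z)) (trans (ℚP.*-identityˡ 1ℚ) (sym (χˢ-refl (u ++ z))))
    cases (no ne) _ = trans (cong (_* χˢ z B) (χ-no (u ≟Ss A) ne)) (trans (ℚP.*-zeroˡ (χˢ z B)) (sym (χ-no (_ ≟Ss _)
      (λ e′ → ne (trans (sym (take-++-exact u z e)) (trans (cong (take (length A)) e′) (take-++-exact A B refl)))))))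
    cases (yes refl) (no ne) = trans (cong (χˢ u u *_) (χ-no (z ≟Ss B) ne)) (trans (ℚP.*-zeroʳ (χˢ u u)) (sym (χ-no (_ ≟Ss _)
      (λ e′ → ne (trans (sym (drop-++-exact u z refl)) (trans (cong (drop (length u)) e′) (drop-++-exact u B refl)))))))

  allSyms : ℕ → List (List Sym)
  allSyms zero = [] ∷ []
  allSyms (suc m) = map (sy ∷_) (allSyms m) ++ map (sz ∷_) (allSyms m)

  allWords : ℕ → List Word
  allWords zero = [] ∷ []
  allWords (suc m) = map (x ∷_) (allWords m) ++ map (y ∷_) (allWords m)

  ∑-allSyms-suc : (m : ℕ) (f : List Sym → ℚ) →
    ∑ (allSyms (suc m)) f ≡ ∑ (allSyms m) (λ u → f (sy ∷ u)) + ∑ (allSyms m) (λ u → f (sz ∷ u))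
  ∑-allSyms-suc m f = trans (∑-++ (map (sy ∷_) (allSyms m)) _ f)
    (cong₂ _+_ (∑-map (sy ∷_) (allSyms m) f) (∑-map (sz ∷_) (allSyms m) f))

  ∑-allWords-suc : (m : ℕ) (f : Word → ℚ) →
    ∑ (allWords (suc m)) f ≡ ∑ (allWords m) (λ u → f (x ∷ u)) + ∑ (allWords m) (λ u → f (y ∷ u))
  ∑-allWords-suc m f = trans (∑-++ (map (x ∷_) (allWords m)) _ f)
    (cong₂ _+_ (∑-map (x ∷_) (allWords m) f) (∑-map (y ∷_) (allWords m) f))

  ∑-allSyms-single : (m : ℕ) (s : List Sym) → length s ≡ m → (f : List Sym → ℚ) →
    (∀ u → ¬ (u ≡ s) → f u ≡ 0ℚ) → ∑ (allSyms m) f ≡ f s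
  ∑-allSyms-single zero [] e f h = ℚP.+-identityʳ _
  ∑-allSyms-single (suc m) (sy ∷ s) e f h = begin
    ∑ (allSyms (suc m)) f                                                ≡⟨ ∑-allSyms-suc m f ⟩
    ∑ (allSyms m) (λ u → f (sy ∷ u)) + ∑ (allSyms m) (λ u → f (sz ∷ u))
      ≡⟨ cong₂ _+_ (∑-allSyms-single m s (ℕP.suc-injective e) _ (λ u ne → h (sy ∷ u) (λ e′ → ne (LP.∷-injectiveʳ e′))))
                   (∑-zero (allSyms m) _ (λ u → h (sz ∷ u) (λ ()))) ⟩
    f (sy ∷ s) + 0ℚ                                                      ≡⟨ ℚP.+-identityʳ _ ⟩
    f (sy ∷ s)                                                           ∎
    where open ≡-Reasoning
  ∑-allSyms-single (suc m) (sz ∷ s) e f h = begin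
    ∑ (allSyms (suc m)) f                                                ≡⟨ ∑-allSyms-suc m f ⟩
    ∑ (allSyms m) (λ u → f (sy ∷ u)) + ∑ (allSyms m) (λ u → f (sz ∷ u))
      ≡⟨ cong₂ _+_ (∑-zero (allSyms m) _ (λ u → h (sy ∷ u) (λ ())))
                   (∑-allSyms-single m s (ℕP.suc-injective e) _ (λ u ne → h (sz ∷ u) (λ e′ → ne (LP.∷-injectiveʳ e′)))) ⟩
    0ℚ + f (sz ∷ s)                                                      ≡⟨ ℚP.+-identityˡ _ ⟩
    f (sz ∷ s)                                                           ∎
    where open ≡-Reasoning

  ∑-allWords-single : (m : ℕ) (s : Word) → length s ≡ m → (f : Word → ℚ) →
    (∀ u → ¬ (u ≡ s) → f u ≡ 0ℚ) → ∑ (allWords m) f ≡ f s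
  ∑-allWords-single zero [] e f h = ℚP.+-identityʳ _
  ∑-allWords-single (suc m) (x ∷ s) e f h = trans (∑-allWords-suc m f)
    (trans (cong₂ _+_ (∑-allWords-single m s (ℕP.suc-injective e) _ (λ u ne → h (x ∷ u) (λ e′ → ne (LP.∷-injectiveʳ e′))))
                      (∑-zero (allWords m) _ (λ u → h (y ∷ u) (λ ()))))
           (ℚP.+-identityʳ _))
  ∑-allWords-single (suc m) (y ∷ s) e f h = trans (∑-allWords-suc m f)
    (trans (cong₂ _+_ (∑-zero (allWords m) _ (λ u → h (x ∷ u) (λ ())))
                      (∑-allWords-single m s (ℕP.suc-injective e) _ (λ u ne → h (y ∷ u) (λ e′ → ne (LP.∷-injectiveʳ e′)))))
           (ℚP.+-identityˡ _))

  ∑-allWords-zero : (m : ℕ) (f : Word → ℚ) → (∀ u → length u ≡ m → f u ≡ 0ℚ) → ∑ (allWords m) f ≡ 0ℚ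
  ∑-allWords-zero zero f h = trans (ℚP.+-identityʳ _) (h [] refl)
  ∑-allWords-zero (suc m) f h = trans (∑-allWords-suc m f)
    (trans (cong₂ _+_ (∑-allWords-zero m _ (λ u e → h (x ∷ u) (cong suc e)))
                      (∑-allWords-zero m _ (λ u e → h (y ∷ u) (cong suc e))))
           (ℚP.+-identityˡ 0ℚ))

  xyCoeffˡ : Sym → Letter → ℚ
  xyCoeffˡ sz _ = 1ℚ
  xyCoeffˡ sy x = 0ℚ
  xyCoeffˡ sy y = 1ℚ

  -- Substituting z = x + y, xyCoeff T w is the coefficient of the word w in T.
  xyCoeff : List Sym → Word → ℚ
  xyCoeff [] [] = 1ℚ
  xyCoeff [] (_ ∷ _) = 0ℚ
  xyCoeff (_ ∷ _) [] = 0ℚ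
  xyCoeff (s ∷ T) (b ∷ w) = xyCoeffˡ s b * xyCoeff T w

  xyCoeffˡ-yzCoeffˡ : (a b : Letter) →
    xyCoeffˡ sy b * yzCoeffˡ a sy + xyCoeffˡ sz b * yzCoeffˡ a sz ≡ χ (a ≟L b)
  xyCoeffˡ-yzCoeffˡ x x = refl
  xyCoeffˡ-yzCoeffˡ x y = refl
  xyCoeffˡ-yzCoeffˡ y x = refl
  xyCoeffˡ-yzCoeffˡ y y = refl

  χʷ-inversion : (u w : Word) → χʷ u w ≡ ∑ (allSyms (length w)) (λ T → xyCoeff T w * yzCoeff u T)
  χʷ-inversion [] [] = refl
  χʷ-inversion (a ∷ u) [] = refl
  χʷ-inversion [] (b ∷ w) = sym (∑-zero (allSyms (suc (length w))) _ vanish)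
    where
    vanish : (T : List Sym) → xyCoeff T (b ∷ w) * yzCoeff [] T ≡ 0ℚ
    vanish [] = ℚP.*-zeroʳ 0ℚ
    vanish (s ∷ T) = ℚP.*-zeroʳ (xyCoeff (s ∷ T) (b ∷ w))
  χʷ-inversion (a ∷ u) (b ∷ w) = sym (begin
    ∑ (allSyms (suc m)) (λ T → xyCoeff T (b ∷ w) * yzCoeff (a ∷ u) T)
      ≡⟨ ∑-allSyms-suc m _ ⟩
    ∑ (allSyms m) (term sy) + ∑ (allSyms m) (term sz)
      ≡⟨ cong₂ _+_ (factor sy) (factor sz) ⟩
    c sy * S + c sz * S
      ≡⟨ sym (ℚP.*-distribʳ-+ S (c sy) (c sz)) ⟩
    (c sy + c sz) * S
      ≡⟨ cong₂ _*_ (xyCoeffˡ-yzCoeffˡ a b) (sym (χʷ-inversion u w)) ⟩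
    χ (a ≟L b) * χʷ u w
      ≡⟨ sym (χʷ-∷∷ a b u w) ⟩
    χʷ (a ∷ u) (b ∷ w)
      ∎)
    where
    open ≡-Reasoning
    m : ℕ
    m = length w
    S : ℚ
    S = ∑ (allSyms m) (λ T → xyCoeff T w * yzCoeff u T)
    c : Sym → ℚ
    c s = xyCoeffˡ s b * yzCoeffˡ a s
    term : Sym → List Sym → ℚ
    term s T = xyCoeff (s ∷ T) (b ∷ w) * yzCoeff (a ∷ u) (s ∷ T)
    factor : (s : Sym) → ∑ (allSyms m) (term s) ≡ c s * S
    factor s = trans (∑-cong (allSyms m) (λ T →
        solve 4 (λ p q r t → (p :* q) :* (r :* t) := (p :* r) :* (q :* t)) refl
          (xyCoeffˡ s b) (xyCoeff T w) (yzCoeffˡ a s) (yzCoeff u T)))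
      (∑-* (allSyms m) (c s) _)

  lin : (Word → ℚ) → Poly → ℚ
  lin f P = ∑ P (λ e → proj₁ e * f (proj₂ e))

  coeff-lin : (P : Poly) (w : Word) → coeff P w ≡ lin (λ u → χʷ u w) P
  coeff-lin [] w = refl
  coeff-lin ((c , u) ∷ P) w with u ≟W w
  ... | yes _ = cong₂ _+_ (sym (ℚP.*-identityʳ c)) (coeff-lin P w)
  ... | no _ = trans (sym (ℚP.+-identityˡ (coeff P w))) (cong₂ _+_ (sym (ℚP.*-zeroʳ c)) (coeff-lin P w))

  coeff-∷ : (c : ℚ) (u : Word) (P : Poly) (w : Word) → coeff ((c , u) ∷ P) w ≡ c * χʷ u w + coeff P w
  coeff-∷ c u P w with u ≟W w
  ... | yes _ = cong (_+ coeff P w) (sym (ℚP.*-identityʳ c))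
  ... | no _ = trans (sym (ℚP.+-identityˡ (coeff P w))) (cong (_+ coeff P w) (sym (ℚP.*-zeroʳ c)))

  lin-via-coeff : (N : ℕ) (f : Word → ℚ) → (∀ u → ¬ (length u ≡ N) → f u ≡ 0ℚ) → (P : Poly) →
    lin f P ≡ ∑ (allWords N) (λ u → f u * coeff P u)
  lin-via-coeff N f supp [] = sym (∑-zero (allWords N) _ (λ u → ℚP.*-zeroʳ (f u)))
  lin-via-coeff N f supp ((c , w) ∷ P) = begin
    c * f w + lin f P
      ≡⟨ cong₂ _+_ single (lin-via-coeff N f supp P) ⟩
    ∑ (allWords N) (λ u → f u * (c * χʷ w u)) + ∑ (allWords N) (λ u → f u * coeff P u)
      ≡⟨ sym (∑-+ (allWords N) _ _) ⟩
    ∑ (allWords N) (λ u → f u * (c * χʷ w u) + f u * coeff P u)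
      ≡⟨ ∑-cong (allWords N) (λ u → trans (sym (ℚP.*-distribˡ-+ (f u) _ _)) (cong (f u *_) (sym (coeff-∷ c w P u)))) ⟩
    ∑ (allWords N) (λ u → f u * coeff ((c , w) ∷ P) u)
      ∎
    where
    open ≡-Reasoning
    off : ∀ u → ¬ (w ≡ u) → f u * (c * χʷ w u) ≡ 0ℚ
    off u ne = trans (cong (λ t → f u * (c * t)) (χ-no (w ≟W u) ne))
      (trans (cong (f u *_) (ℚP.*-zeroʳ c)) (ℚP.*-zeroʳ (f u)))
    single : c * f w ≡ ∑ (allWords N) (λ u → f u * (c * χʷ w u))
    single with length w ℕP.≟ N
    ... | yes e = sym (trans (∑-allWords-single N w e _ (λ u ne → off u (λ e′ → ne (sym e′))))
      (trans (cong (λ t → f w * (c * t)) (χʷ-refl w))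
        (trans (cong (f w *_) (ℚP.*-identityʳ c)) (ℚP.*-comm (f w) c))))
    ... | no ne = trans (cong (c *_) (supp w ne)) (trans (ℚP.*-zeroʳ c)
      (sym (∑-allWords-zero N _ (λ u eu → off u (λ e′ → ne (trans (cong length e′) eu))))))

  lin-resp-≈ : (N : ℕ) (f : Word → ℚ) → (∀ u → ¬ (length u ≡ N) → f u ≡ 0ℚ) →
    (P Q : Poly) → P ≈ₚ Q → lin f P ≡ lin f Q
  lin-resp-≈ N f supp P Q e = trans (lin-via-coeff N f supp P)
    (trans (∑-cong (allWords N) (λ u → cong (f u *_) (e u))) (sym (lin-via-coeff N f supp Q)))

  coeff-via-yzCoeffs : (P : Poly) (w : Word) →
    coeff P w ≡ ∑ (allSyms (length w)) (λ T → xyCoeff T w * lin (λ u → yzCoeff u T) P)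
  coeff-via-yzCoeffs P w = begin
    coeff P w
      ≡⟨ coeff-lin P w ⟩
    ∑ P (λ e → proj₁ e * χʷ (proj₂ e) w)
      ≡⟨ ∑-cong P (λ e → trans (cong (proj₁ e *_) (χʷ-inversion (proj₂ e) w)) (sym (∑-* Ts (proj₁ e) _))) ⟩
    ∑ P (λ e → ∑ Ts (λ T → proj₁ e * (xyCoeff T w * yzCoeff (proj₂ e) T)))
      ≡⟨ ∑-swap P Ts _ ⟩
    ∑ Ts (λ T → ∑ P (λ e → proj₁ e * (xyCoeff T w * yzCoeff (proj₂ e) T)))
      ≡⟨ ∑-cong Ts (λ T → trans (∑-cong P (λ e →
           solve 3 (λ c a b → c :* (a :* b) := a :* (c :* b)) refl (proj₁ e) (xyCoeff T w) (yzCoeff (proj₂ e) T)))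
           (∑-* P (xyCoeff T w) _)) ⟩
    ∑ Ts (λ T → xyCoeff T w * lin (λ u → yzCoeff u T) P)
      ∎
    where
    open ≡-Reasoning
    Ts : List (List Sym)
    Ts = allSyms (length w)

  ≈-from-yzCoeffs : (P Q : Poly) → (∀ T → lin (λ u → yzCoeff u T) P ≡ lin (λ u → yzCoeff u T) Q) → P ≈ₚ Q
  ≈-from-yzCoeffs P Q h w = trans (coeff-via-yzCoeffs P w)
    (trans (∑-cong (allSyms (length w)) (λ T → cong (xyCoeff T w *_) (h T))) (sym (coeff-via-yzCoeffs Q w)))

  expand : List Sym → List Word
  expand [] = [] ∷ []
  expand (sy ∷ u) = map (y ∷_) (expand u)
  expand (sz ∷ u) = map (x ∷_) (expand u) ++ map (y ∷_) (expand u)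

  ∑-expand-yzCoeff : (u s : List Sym) → ∑ (expand u) (λ w → yzCoeff w s) ≡ χˢ u s
  ∑-expand-yzCoeff [] [] = refl
  ∑-expand-yzCoeff [] (t ∷ s) = refl
  ∑-expand-yzCoeff (sy ∷ u) [] = trans (∑-map (y ∷_) (expand u) _) (∑-zero (expand u) _ (λ _ → refl))
  ∑-expand-yzCoeff (sz ∷ u) [] = trans (∑-++ (map (x ∷_) (expand u)) _ _)
    (cong₂ _+_ (trans (∑-map (x ∷_) (expand u) _) (∑-zero (expand u) _ (λ _ → refl)))
               (trans (∑-map (y ∷_) (expand u) _) (∑-zero (expand u) _ (λ _ → refl))))
  ∑-expand-yzCoeff (sy ∷ u) (t ∷ s) = begin
    ∑ (map (y ∷_) (expand u)) (λ w → yzCoeff w (t ∷ s))   ≡⟨ ∑-map (y ∷_) (expand u) _ ⟩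
    ∑ (expand u) (λ w → yzCoeffˡ y t * yzCoeff w s)       ≡⟨ ∑-* (expand u) (yzCoeffˡ y t) _ ⟩
    yzCoeffˡ y t * ∑ (expand u) (λ w → yzCoeff w s)       ≡⟨ cong₂ _*_ (letter t) (∑-expand-yzCoeff u s) ⟩
    χ (sy ≟S t) * χˢ u s                                  ≡⟨ sym (χˢ-∷∷ sy t u s) ⟩
    χˢ (sy ∷ u) (t ∷ s)                                   ∎
    where
    open ≡-Reasoning
    letter : (t : Sym) → yzCoeffˡ y t ≡ χ (sy ≟S t)
    letter sy = refl
    letter sz = refl
  ∑-expand-yzCoeff (sz ∷ u) (t ∷ s) = begin
    ∑ (map (x ∷_) (expand u) ++ map (y ∷_) (expand u)) (λ w → yzCoeff w (t ∷ s))
      ≡⟨ ∑-++ (map (x ∷_) (expand u)) _ _ ⟩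
    ∑ (map (x ∷_) (expand u)) (λ w → yzCoeff w (t ∷ s)) + ∑ (map (y ∷_) (expand u)) (λ w → yzCoeff w (t ∷ s))
      ≡⟨ cong₂ _+_ (trans (∑-map (x ∷_) (expand u) _) (∑-* (expand u) (yzCoeffˡ x t) _))
                   (trans (∑-map (y ∷_) (expand u) _) (∑-* (expand u) (yzCoeffˡ y t) _)) ⟩
    yzCoeffˡ x t * S + yzCoeffˡ y t * S
      ≡⟨ sym (ℚP.*-distribʳ-+ S (yzCoeffˡ x t) (yzCoeffˡ y t)) ⟩
    (yzCoeffˡ x t + yzCoeffˡ y t) * S
      ≡⟨ cong₂ _*_ (letter t) (∑-expand-yzCoeff u s) ⟩
    χ (sz ≟S t) * χˢ u s
      ≡⟨ sym (χˢ-∷∷ sz t u s) ⟩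
    χˢ (sz ∷ u) (t ∷ s)
      ∎
    where
    open ≡-Reasoning
    S : ℚ
    S = ∑ (expand u) (λ w → yzCoeff w s)
    letter : (t : Sym) → yzCoeffˡ x t + yzCoeffˡ y t ≡ χ (sz ≟S t)
    letter sy = refl
    letter sz = refl

module Rotations where

  open import Defs using (Sym; rot; rot1)
  open Sums
  open ChangeOfBasis using (_≟Ss_; χ; χ-yes; χ-no; χ-⇔; χˢ)
  open import Data.Nat using (ℕ; zero; suc; _<_) renaming (_+_ to _+ℕ_)
  import Data.Nat.Properties as ℕP
  open import Data.Rational using (ℚ; 0ℚ; 1ℚ; _+_; _≤_)
  import Data.Rational.Properties as ℚP
  open import Algebra.Properties.Group ℚP.+-0-group using (∙-cancelʳ)
  open import Data.List using (List; []; _∷_; _++_; length)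
  import Data.List.Properties as LP
  open import Data.Vec using (Vec; toList) renaming ([] to []ᵥ; _∷_ to _∷ᵥ_)
  import Data.Vec.Properties as VP
  open import Relation.Nullary using (¬_; Dec; yes; no)
  open import Relation.Binary.PropositionalEquality

  rotate : {A : Set} → ℕ → List A → List A
  rotate zero l = l
  rotate (suc j) [] = []
  rotate (suc j) (a ∷ l) = rotate j (l ++ a ∷ [])

  module _ {A : Set} where

    rotate-[] : (j : ℕ) → rotate {A} j [] ≡ []
    rotate-[] zero = refl
    rotate-[] (suc j) = refl

    length-rotate : (j : ℕ) (l : List A) → length (rotate j l) ≡ length l
    length-rotate zero l = refl
    length-rotate (suc j) [] = refl
    length-rotate (suc j) (a ∷ l) =
      trans (length-rotate j (l ++ a ∷ [])) (trans (LP.length-++ l) (ℕP.+-comm (length l) 1))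

    rotate-+ : (i j : ℕ) (l : List A) → rotate (i +ℕ j) l ≡ rotate j (rotate i l)
    rotate-+ zero j l = refl
    rotate-+ (suc i) j [] = trans (rotate-[] (suc i +ℕ j)) (sym (rotate-[] j))
    rotate-+ (suc i) j (a ∷ l) = rotate-+ i j (l ++ a ∷ [])

    rotate-comm : (i j : ℕ) (l : List A) → rotate i (rotate j l) ≡ rotate j (rotate i l)
    rotate-comm i j l =
      trans (sym (rotate-+ j i l)) (trans (cong (λ m → rotate m l) (ℕP.+-comm j i)) (rotate-+ i j l))

    rotate-suc : (j : ℕ) (l : List A) → rotate (suc j) l ≡ rotate 1 (rotate j l)
    rotate-suc j l = trans (cong (λ m → rotate m l) (ℕP.+-comm 1 j)) (rotate-+ j 1 l)

    rotate-++ : (xs ys : List A) → rotate (length xs) (xs ++ ys) ≡ ys ++ xs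
    rotate-++ [] ys = sym (LP.++-identityʳ ys)
    rotate-++ (a ∷ xs) ys = begin
      rotate (length xs) ((xs ++ ys) ++ a ∷ [])   ≡⟨ cong (rotate (length xs)) (LP.++-assoc xs ys (a ∷ [])) ⟩
      rotate (length xs) (xs ++ ys ++ a ∷ [])     ≡⟨ rotate-++ xs (ys ++ a ∷ []) ⟩
      (ys ++ a ∷ []) ++ xs                        ≡⟨ LP.++-assoc ys (a ∷ []) xs ⟩
      ys ++ a ∷ xs                                ∎
      where open ≡-Reasoning

    rotate-++-exact : (xs ys : List A) {n : ℕ} → length xs ≡ n → rotate n (xs ++ ys) ≡ ys ++ xs
    rotate-++-exact xs ys refl = rotate-++ xs ys

    rotate-∷-++ : (a : A) (xs ys : List A) {j : ℕ} → length xs ≡ j → rotate (suc j) (a ∷ xs ++ ys) ≡ ys ++ a ∷ xs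
    rotate-∷-++ a xs ys refl = rotate-++ (a ∷ xs) ys

    rotate-length : (l : List A) → rotate (length l) l ≡ l
    rotate-length l = trans (cong (rotate (length l)) (sym (LP.++-identityʳ l))) (rotate-++ l [])

    rotate-period : (l : List A) {L : ℕ} → length l ≡ L → (j : ℕ) → rotate (L +ℕ j) l ≡ rotate j l
    rotate-period l refl j = trans (rotate-+ (length l) j l) (cong (rotate j) (rotate-length l))

    rotate-inverse : (L : ℕ) (l : List A) → length l ≡ suc L → rotate L (rotate 1 l) ≡ l
    rotate-inverse L l e =
      trans (sym (rotate-+ 1 L l)) (trans (cong (λ m → rotate m l) (sym e)) (rotate-length l))

  toList-rot : {A : Set} {l : ℕ} (j : ℕ) (v : Vec A l) → toList (rot j v) ≡ rotate j (toList v)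
  toList-rot zero v = refl
  toList-rot (suc j) []ᵥ = trans (toList-rot j []ᵥ) (rotate-[] j)
  toList-rot (suc j) (a ∷ᵥ v) = trans (toList-rot j (rot1 (a ∷ᵥ v))) (cong (rotate j) (VP.toList-∷ʳ a v))

  rotationCount : ℕ → List Sym → List Sym → ℚ
  rotationCount L Y A = ∑< L (λ i → χˢ A (rotate (suc i) Y))

  rotationCount-rotate₁ˡ : (L : ℕ) (Y A : List Sym) → length Y ≡ L →
    rotationCount L (rotate 1 Y) A ≡ rotationCount L Y A
  rotationCount-rotate₁ˡ L Y A e = ∙-cancelʳ (f 0) _ _ (begin
    rotationCount L (rotate 1 Y) A + f 0
      ≡⟨ cong (_+ f 0) (∑<-cong L (λ i _ → cong (χˢ A) (sym (rotate-+ 1 (suc i) Y)))) ⟩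
    ∑< L (λ i → f (suc i)) + f 0
      ≡⟨ ∑<-shift L f ⟩
    rotationCount L Y A + f L
      ≡⟨ cong (λ m → rotationCount L Y A + χˢ A m)
           (trans (cong (λ m → rotate m Y) (ℕP.+-comm 1 L)) (rotate-period Y e 1)) ⟩
    rotationCount L Y A + f 0
      ∎)
    where
    open ≡-Reasoning
    f : ℕ → ℚ
    f i = χˢ A (rotate (suc i) Y)

  rotationCount-rotateˡ : (L j : ℕ) (Y A : List Sym) → length Y ≡ L →
    rotationCount L (rotate j Y) A ≡ rotationCount L Y A
  rotationCount-rotateˡ L zero Y A e = refl
  rotationCount-rotateˡ L (suc j) Y A e = begin
    rotationCount L (rotate (suc j) Y) A   ≡⟨ cong (λ Z → rotationCount L Z A) (rotate-suc j Y) ⟩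
    rotationCount L (rotate 1 (rotate j Y)) A
      ≡⟨ rotationCount-rotate₁ˡ L (rotate j Y) A (trans (length-rotate j Y) e) ⟩
    rotationCount L (rotate j Y) A         ≡⟨ rotationCount-rotateˡ L j Y A e ⟩
    rotationCount L Y A                    ∎
    where open ≡-Reasoning

  rotationCount-rotate₁ʳ : (L : ℕ) (Y A : List Sym) → length Y ≡ suc L → length A ≡ suc L →
    rotationCount (suc L) Y (rotate 1 A) ≡ rotationCount (suc L) Y A
  rotationCount-rotate₁ʳ L Y A eY eA = begin
    rotationCount (suc L) Y (rotate 1 A)
      ≡⟨ ∑<-cong (suc L) (λ i _ → trans (χ-⇔ (_ ≟Ss _) (_ ≟Ss _)
           (λ e → trans (sym (rotate-inverse L A eA)) (cong (rotate L) e))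
           (λ e → trans (cong (rotate 1) e) (trans (rotate-comm 1 L _) (rotate-inverse L _ (eR i)))))
           (cong (χˢ A) (sym (rotate-comm (suc i) L Y)))) ⟩
    rotationCount (suc L) (rotate L Y) A
      ≡⟨ rotationCount-rotateˡ (suc L) L Y A eY ⟩
    rotationCount (suc L) Y A
      ∎
    where
    open ≡-Reasoning
    eR : ∀ i → length (rotate (suc i) Y) ≡ suc L
    eR i = trans (length-rotate (suc i) Y) eY

  rotationCount-rotateʳ : (L j : ℕ) (Y A : List Sym) → length Y ≡ L → length A ≡ L →
    rotationCount L Y (rotate j A) ≡ rotationCount L Y A
  rotationCount-rotateʳ zero j Y A eY eA = refl
  rotationCount-rotateʳ (suc L) zero Y A eY eA = refl
  rotationCount-rotateʳ (suc L) (suc j) Y A eY eA = begin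
    rotationCount (suc L) Y (rotate (suc j) A)   ≡⟨ cong (rotationCount (suc L) Y) (rotate-suc j A) ⟩
    rotationCount (suc L) Y (rotate 1 (rotate j A))
      ≡⟨ rotationCount-rotate₁ʳ L Y (rotate j A) eY (trans (length-rotate j A) eA) ⟩
    rotationCount (suc L) Y (rotate j A)         ≡⟨ rotationCount-rotateʳ (suc L) j Y A eY eA ⟩
    rotationCount (suc L) Y A                    ∎
    where open ≡-Reasoning

  rotationCount-zero : (L : ℕ) (Y A : List Sym) → (∀ j → j < L → ¬ (rotate (suc j) Y ≡ A)) →
    rotationCount L Y A ≡ 0ℚ
  rotationCount-zero L Y A h = ∑<-zero L _ (λ j lt → χ-no (_ ≟Ss _) (λ e → h j lt (sym e)))

  χ-nonneg : {P : Set} (d : Dec P) → 0ℚ ≤ χ {P} d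
  χ-nonneg (yes _) = ℚP.nonNegative⁻¹ 1ℚ
  χ-nonneg (no _) = ℚP.≤-refl

  rotationCount-nonzero : (L : ℕ) (Y A : List Sym) (j : ℕ) → j < L → rotate (suc j) Y ≡ A →
    ¬ (rotationCount L Y A ≡ 0ℚ)
  rotationCount-nonzero L Y A j lt e z = ℚP.1≢0 (ℚP.≤-antisym
    (subst₂ _≤_ (χ-yes (A ≟Ss _) (sym e)) z (∑<-≥-term L _ (λ i → χ-nonneg (A ≟Ss _)) j lt))
    (ℚP.nonNegative⁻¹ 1ℚ))

module RhoFormula where

  open import Defs
  open Sums
  open Lists
  open ChangeOfBasis
  open Rotations
  open import Data.Nat using (ℕ; zero; suc; _<_) renaming (_+_ to _+ℕ_)
  import Data.Nat.Properties as ℕP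
  open import Data.Rational using (ℚ; 0ℚ; 1ℚ; -_; _+_; _*_)
  import Data.Rational.Properties as ℚP
  open import Data.Rational.Solver using (module +-*-Solver)
  open import Data.List using (List; []; _∷_; _++_; map; concat; length; take; drop; replicate; initLast; _∷ʳ′_)
  import Data.List.Properties as LP
  open import Data.List.Relation.Unary.All using (All; []; _∷_)
  import Data.List.Relation.Unary.All as All
  import Data.List.Relation.Unary.All.Properties as AllP
  open import Data.Vec using (Vec; toList)
  open import Data.Product using (Σ; _,_; proj₁; proj₂)
  open import Relation.Nullary using (¬_; yes; no)
  open import Relation.Binary.PropositionalEquality
  open +-*-Solver

  record Split : Set where
    constructor _∣_∣_
    field
      before : Word
      letter : Letter
      after : Word
  open Split

  splits : Word → List Split
  splits [] = []
  splits (a ∷ w) = ([] ∣ a ∣ w) ∷ map (λ s → (a ∷ before s) ∣ letter s ∣ after s) (splits w)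

  splits-sound : (w : Word) → All (λ s → before s ++ letter s ∷ after s ≡ w) (splits w)
  splits-sound [] = []
  splits-sound (a ∷ w) = refl ∷ AllP.map⁺ (All.map (cong (a ∷_)) (splits-sound w))

  ∑-splits-length : (w : Word) (G : ℕ → ℚ) → ∑ (splits w) (λ s → G (length (after s))) ≡ ∑< (length w) G
  ∑-splits-length [] G = refl
  ∑-splits-length (a ∷ w) G = trans (cong (G (length w) +_) (trans (∑-map _ (splits w) _) (∑-splits-length w G)))
    (ℚP.+-comm (G (length w)) _)

  sgn : Letter → ℚ
  sgn x = 1ℚ
  sgn y = - 1ℚ

  linᵀ : {n : ℕ} → (Word → Vec Word n → Word → ℚ) → Tens n → ℚ
  linᵀ g T = ∑ T (λ e → proj₁ e * g (proj₁ (proj₂ e)) (proj₁ (proj₂ (proj₂ e))) (proj₂ (proj₂ (proj₂ e))))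

  linᵀ-Cword : (n : ℕ) (w : Word) (g : Word → Vec Word n → Word → ℚ) →
    linᵀ g (Cword n w) ≡ ∑ (splits w) (λ s → sgn (letter s) * ∑ (zTensors n) (λ t → g (x ∷ after s) t (before s ++ y ∷ [])))
  linᵀ-Cword n [] g = refl
  linᵀ-Cword n (a ∷ w) g = begin
    linᵀ g (map (actR w) (Cletter n a) ++ map (actL (a ∷ [])) (Cword n w))
      ≡⟨ ∑-++ (map (actR w) (Cletter n a)) _ _ ⟩
    linᵀ g (map (actR w) (Cletter n a)) + linᵀ g (map (actL (a ∷ [])) (Cword n w))
      ≡⟨ cong₂ _+_ (first a) (trans (∑-map (actL (a ∷ [])) (Cword n w) _) (linᵀ-Cword n w (λ f m l → g f m (a ∷ l)))) ⟩
    sgn a * ∑ (zTensors n) (λ t → g (x ∷ w) t (y ∷ [])) +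
      ∑ (splits w) (λ s → sgn (letter s) * ∑ (zTensors n) (λ t → g (x ∷ after s) t (a ∷ before s ++ y ∷ [])))
      ≡⟨ cong (sgn a * ∑ (zTensors n) (λ t → g (x ∷ w) t (y ∷ [])) +_) (sym (∑-map _ (splits w) _)) ⟩
    ∑ (splits (a ∷ w)) (λ s → sgn (letter s) * ∑ (zTensors n) (λ t → g (x ∷ after s) t (before s ++ y ∷ [])))
      ∎
    where
    open ≡-Reasoning
    first : (a : Letter) → linᵀ g (map (actR w) (Cletter n a)) ≡ sgn a * ∑ (zTensors n) (λ t → g (x ∷ w) t (y ∷ []))
    first x = trans (∑-map (actR w) (Cletter n x) _) (trans (∑-map _ (zTensors n) _) (∑-* (zTensors n) 1ℚ _))
    first y = trans (∑-map (actR w) (Cletter n y) _) (trans (∑-map _ (zTensors n) _) (∑-* (zTensors n) (- 1ℚ) _))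

  -- ρₙ(w) = Σ over w = p a q of sgn(a) · x q zⁿ p y; ρCore pairs the part q zⁿ p with h.
  ρCore : (n : ℕ) → Word → (Word → ℚ) → ℚ
  ρCore n w h = ∑ (splits w) (λ s → sgn (letter s) * ∑ (zTensors n) (λ t → h (after s ++ concat (toList t) ++ before s)))

  ρCore-cong : (n : ℕ) (w : Word) {h h′ : Word → ℚ} → (∀ S → h S ≡ h′ S) → ρCore n w h ≡ ρCore n w h′
  ρCore-cong n w e = ∑-cong (splits w) (λ s → cong (sgn (letter s) *_) (∑-cong (zTensors n) (λ t → e _)))

  ρCore-* : (n : ℕ) (w : Word) (c : ℚ) (h : Word → ℚ) → ρCore n w (λ S → c * h S) ≡ c * ρCore n w h
  ρCore-* n w c h = trans
    (∑-cong (splits w) (λ s → trans (cong (sgn (letter s) *_) (∑-* (zTensors n) c _))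
      (solve 3 (λ a b d → a :* (b :* d) := b :* (a :* d)) refl (sgn (letter s)) c _)))
    (∑-* (splits w) c _)

  lin-ρ : (n : ℕ) (f : Word → ℚ) (P : Poly) →
    lin f (ρ n P) ≡ ∑ P (λ e → proj₁ e * ρCore n (proj₂ e) (λ S → f (x ∷ S ++ y ∷ [])))
  lin-ρ n f P = begin
    lin f (Mn n (Cn n P))
      ≡⟨ ∑-map _ (Cn n P) _ ⟩
    linᵀ g (Cn n P)
      ≡⟨ linᵀ-Cn P ⟩
    ∑ P (λ e → proj₁ e * linᵀ g (Cword n (proj₂ e)))
      ≡⟨ ∑-cong P (λ e → cong (proj₁ e *_) (trans (linᵀ-Cword n (proj₂ e) g)
           (∑-cong (splits (proj₂ e)) (λ s → cong (sgn (letter s) *_) (∑-cong (zTensors n)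
             (λ t → cong f (reassoc (after s) (concat (toList t)) (before s)))))))) ⟩
    ∑ P (λ e → proj₁ e * ρCore n (proj₂ e) (λ S → f (x ∷ S ++ y ∷ [])))
      ∎
    where
    open ≡-Reasoning
    g : Word → Vec Word n → Word → ℚ
    g a m l = f (a ++ concat (toList m) ++ l)
    linᵀ-Cn : (P : Poly) → linᵀ g (Cn n P) ≡ ∑ P (λ e → proj₁ e * linᵀ g (Cword n (proj₂ e)))
    linᵀ-Cn [] = refl
    linᵀ-Cn ((c , w) ∷ P) = trans (∑-++ (map _ (Cword n w)) (Cn n P) _)
      (cong₂ _+_ (trans (∑-map _ (Cword n w) _)
                   (trans (∑-cong (Cword n w) (λ e → ℚP.*-assoc c (proj₁ e) _)) (∑-* (Cword n w) c _)))
                 (linᵀ-Cn P))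
    reassoc : (q c p : Word) → (x ∷ q) ++ c ++ p ++ y ∷ [] ≡ x ∷ (q ++ c ++ p) ++ y ∷ []
    reassoc q c p = cong (x ∷_) (trans (cong (q ++_) (sym (LP.++-assoc c p (y ∷ [])))) (sym (LP.++-assoc q (c ++ p) (y ∷ []))))

  yzCoeff-frame : (T : List Sym) → Σ ℚ λ κ → Σ (List Sym) λ V → ∀ S → yzCoeff (x ∷ S ++ y ∷ []) T ≡ κ * yzCoeff S V
  yzCoeff-frame [] = 0ℚ , [] , λ S → sym (ℚP.*-zeroˡ (yzCoeff S []))
  yzCoeff-frame (t₀ ∷ T) with initLast T
  ... | [] = 0ℚ , [] , λ S → trans (cong (yzCoeffˡ x t₀ *_) (yzCoeff-length (S ++ y ∷ []) [] (λ e → nonempty S e)))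
      (trans (ℚP.*-zeroʳ (yzCoeffˡ x t₀)) (sym (ℚP.*-zeroˡ (yzCoeff S []))))
    where
    nonempty : (S : Word) → ¬ (length (S ++ y ∷ []) ≡ 0)
    nonempty S e with () ← trans (sym (length-∷ʳ S y)) e
  ... | V ∷ʳ′ t = yzCoeffˡ x t₀ * yzCoeffˡ y t , V , λ S →
      trans (cong (yzCoeffˡ x t₀ *_) (yzCoeff-∷ʳ S y V t))
        (solve 3 (λ a b c → a :* (b :* c) := a :* c :* b) refl (yzCoeffˡ x t₀) (yzCoeff S V) (yzCoeffˡ y t))

  ρCoeff : ℕ → Poly → List Sym → ℚ
  ρCoeff n P V = ∑ P (λ e → proj₁ e * ρCore n (proj₂ e) (λ S → yzCoeff S V))

  lin-ρ-frame : (n : ℕ) (f : Word → ℚ) (κ : ℚ) (V : List Sym) → (∀ S → f (x ∷ S ++ y ∷ []) ≡ κ * yzCoeff S V) →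
    (P : Poly) → lin f (ρ n P) ≡ κ * ρCoeff n P V
  lin-ρ-frame n f κ V h P = trans (lin-ρ n f P) (trans (∑-cong P (λ e → trans
      (cong (proj₁ e *_) (trans (ρCore-cong n (proj₂ e) h) (ρCore-* n (proj₂ e) κ (λ S → yzCoeff S V))))
      (solve 3 (λ c k r → c :* (k :* r) := k :* (c :* r)) refl (proj₁ e) κ (ρCore n (proj₂ e) (λ S → yzCoeff S V)))))
    (∑-* P κ _))

  χᶻ : ℕ → List Sym → ℚ
  χᶻ zero [] = 1ℚ
  χᶻ zero (_ ∷ _) = 0ℚ
  χᶻ (suc n) [] = 0ℚ
  χᶻ (suc n) (sy ∷ s) = 0ℚ
  χᶻ (suc n) (sz ∷ s) = χᶻ n s

  χᶻ-sy : (n : ℕ) (B C : List Sym) → χᶻ n (B ++ sy ∷ C) ≡ 0ℚ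
  χᶻ-sy zero [] C = refl
  χᶻ-sy zero (_ ∷ _) C = refl
  χᶻ-sy (suc n) [] C = refl
  χᶻ-sy (suc n) (sy ∷ B) C = refl
  χᶻ-sy (suc n) (sz ∷ B) C = χᶻ-sy n B C

  χᶻ≡χˢ : (n : ℕ) (B : List Sym) → χᶻ n B ≡ χˢ (replicate n sz) B
  χᶻ≡χˢ zero [] = refl
  χᶻ≡χˢ zero (b ∷ B) = refl
  χᶻ≡χˢ (suc n) [] = refl
  χᶻ≡χˢ (suc n) (sy ∷ B) = sym (χˢ-∷-≢ {sz} {sy} (replicate n sz) B (λ ()))
  χᶻ≡χˢ (suc n) (sz ∷ B) = trans (χᶻ≡χˢ n B) (sym (χˢ-∷ sz (replicate n sz) B))

  zTensors-length : (n : ℕ) → All (λ t → length (concat (toList t)) ≡ n) (zTensors n)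
  zTensors-length zero = refl ∷ []
  zTensors-length (suc n) = AllP.concat⁺ (AllP.map⁺ (All.map (λ e → cong suc e ∷ cong suc e ∷ []) (zTensors-length n)))

  ∑-zTensors-yzCoeff : (n : ℕ) (r : Word) (V : List Sym) →
    ∑ (zTensors n) (λ t → yzCoeff (concat (toList t) ++ r) V) ≡ χᶻ n (take n V) * yzCoeff r (drop n V)
  ∑-zTensors-yzCoeff zero r V = trans (ℚP.+-identityʳ (yzCoeff r V)) (sym (ℚP.*-identityˡ (yzCoeff r V)))
  ∑-zTensors-yzCoeff (suc n) r V = trans (∑-concatMap _ (zTensors n) _) (step V)
    where
    F : Vec Word n → List Sym → ℚ
    F m V = yzCoeff (concat (toList m) ++ r) V
    step : (V : List Sym) → ∑ (zTensors n) (λ m → yzCoeff (x ∷ concat (toList m) ++ r) V + (yzCoeff (y ∷ concat (toList m) ++ r) V + 0ℚ))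
                          ≡ χᶻ (suc n) (take (suc n) V) * yzCoeff r (drop (suc n) V)
    step [] = trans (∑-zero (zTensors n) _ (λ _ → refl)) (sym (ℚP.*-zeroˡ (yzCoeff r [])))
    step (sy ∷ V) = trans (∑-zero (zTensors n) _ (λ m →
        solve 1 (λ p → (:- con 1ℚ) :* p :+ (con 1ℚ :* p :+ con 0ℚ) := con 0ℚ) refl (F m V)))
      (sym (ℚP.*-zeroˡ (yzCoeff r (drop n V))))
    step (sz ∷ V) = trans (∑-cong (zTensors n) (λ m →
        solve 1 (λ p → con 1ℚ :* p :+ (con 0ℚ :* p :+ con 0ℚ) := p) refl (F m V)))
      (∑-zTensors-yzCoeff n r V)

  -- the term of the split of w at position m, read cyclically off V
  splitTerm : ℕ → Word → List Sym → ℕ → ℚ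
  splitTerm n w V m = χᶻ n (take n (drop m V)) * yzCoeff w (drop n (drop m V) ++ sy ∷ take m V)

  ρCore-yzCoeff-split : (n : ℕ) (p : Word) (a : Letter) (q : Word) (V : List Sym) →
    suc (length V) ≡ length (p ++ a ∷ q) +ℕ n →
    sgn a * ∑ (zTensors n) (λ t → yzCoeff (q ++ concat (toList t) ++ p) V) ≡ - splitTerm n (p ++ a ∷ q) V (length q)
  ρCore-yzCoeff-split n p a q V e
    with splitAt-length V (length q) (n +ℕ length p) (ℕP.suc-injective (trans e (length-split p a q n)))
  ... | V₁ , V′ , refl , e₁ , e′ with splitAt-length V′ n (length p) e′
  ... | V₂ , V₃ , refl , e₂ , e₃ = begin
    sgn a * ∑ (zTensors n) (λ t → yzCoeff (q ++ concat (toList t) ++ p) (V₁ ++ V₂ ++ V₃))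
      ≡⟨ cong (sgn a *_) (trans (∑-cong (zTensors n) (λ t → yzCoeff-++-exact q _ V₁ _ (sym e₁)))
           (trans (∑-* (zTensors n) (yzCoeff q V₁) _) (cong (yzCoeff q V₁ *_) (∑-zTensors-yzCoeff n p (V₂ ++ V₃))))) ⟩
    sgn a * (yzCoeff q V₁ * (χᶻ n (take n (V₂ ++ V₃)) * yzCoeff p (drop n (V₂ ++ V₃))))
      ≡⟨ cong₂ (λ A B → sgn a * (yzCoeff q V₁ * (χᶻ n A * yzCoeff p B)))
           (take-++-exact V₂ V₃ e₂) (drop-++-exact V₂ V₃ e₂) ⟩
    sgn a * (yzCoeff q V₁ * (χᶻ n V₂ * yzCoeff p V₃))
      ≡⟨ cong (_* _) (sgn≡ a) ⟩
    - yzCoeffˡ a sy * (yzCoeff q V₁ * (χᶻ n V₂ * yzCoeff p V₃))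
      ≡⟨ solve 4 (λ d q z p → (:- d) :* (q :* (z :* p)) := :- (z :* (p :* (d :* q)))) refl
           (yzCoeffˡ a sy) (yzCoeff q V₁) (χᶻ n V₂) (yzCoeff p V₃) ⟩
    - (χᶻ n V₂ * (yzCoeff p V₃ * yzCoeff (a ∷ q) (sy ∷ V₁)))
      ≡⟨ cong (λ r → - (χᶻ n V₂ * r)) (sym (yzCoeff-++-exact p (a ∷ q) V₃ (sy ∷ V₁) (sym e₃))) ⟩
    - (χᶻ n V₂ * yzCoeff (p ++ a ∷ q) (V₃ ++ sy ∷ V₁))
      ≡⟨ cong₂ (λ A B → - (χᶻ n A * yzCoeff (p ++ a ∷ q) (B ++ sy ∷ V₁)))
           (sym (take-++-exact V₂ V₃ e₂)) (sym (drop-++-exact V₂ V₃ e₂)) ⟩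
    - (χᶻ n (take n (V₂ ++ V₃)) * yzCoeff (p ++ a ∷ q) (drop n (V₂ ++ V₃) ++ sy ∷ V₁))
      ≡⟨ cong₂ (λ A B → - (χᶻ n (take n A) * yzCoeff (p ++ a ∷ q) (drop n A ++ sy ∷ B)))
           (sym (drop-++-exact V₁ (V₂ ++ V₃) e₁)) (sym (take-++-exact V₁ (V₂ ++ V₃) e₁)) ⟩
    - splitTerm n (p ++ a ∷ q) (V₁ ++ V₂ ++ V₃) (length q)
      ∎
    where
    open ≡-Reasoning
    sgn≡ : (a : Letter) → sgn a ≡ - yzCoeffˡ a sy
    sgn≡ x = refl
    sgn≡ y = refl

  ρCore-yzCoeff : (n : ℕ) (w : Word) (V : List Sym) → suc (length V) ≡ length w +ℕ n →
    ρCore n w (λ S → yzCoeff S V) ≡ - ∑< (length w) (splitTerm n w V)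
  ρCore-yzCoeff n w V e = begin
    ρCore n w (λ S → yzCoeff S V)
      ≡⟨ ∑-congᴬ (splits w) (splits-sound w) (λ { (p ∣ a ∣ q) refl → ρCore-yzCoeff-split n p a q V e }) ⟩
    ∑ (splits w) (λ s → - splitTerm n w V (length (after s)))
      ≡⟨ ∑-neg (splits w) _ ⟩
    - ∑ (splits w) (λ s → splitTerm n w V (length (after s)))
      ≡⟨ cong -_ (∑-splits-length w (splitTerm n w V)) ⟩
    - ∑< (length w) (splitTerm n w V)
      ∎
    where open ≡-Reasoning

  ρCore-yzCoeff-length : (n : ℕ) (w : Word) (V : List Sym) → ¬ (suc (length V) ≡ length w +ℕ n) →
    ρCore n w (λ S → yzCoeff S V) ≡ 0ℚ
  ρCore-yzCoeff-length n w V ne = ∑-zeroᴬ (splits w) _ (splits-sound w) λ { (p ∣ a ∣ q) ew →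
    trans (cong (sgn a *_) (∑-zeroᴬ (zTensors n) _ (zTensors-length n)
                             (λ t et → yzCoeff-length (q ++ concat (toList t) ++ p) V (mismatch p a q t et ew))))
          (ℚP.*-zeroʳ (sgn a)) }
    where
    mismatch : (p : Word) (a : Letter) (q : Word) (t : Vec Word n) → length (concat (toList t)) ≡ n →
      p ++ a ∷ q ≡ w → ¬ (length (q ++ concat (toList t) ++ p) ≡ length V)
    mismatch p a q t et refl eV = ne (begin
      suc (length V)
        ≡⟨ cong suc (sym eV) ⟩
      suc (length (q ++ concat (toList t) ++ p))
        ≡⟨ cong suc (trans (LP.length-++ q) (cong (length q +ℕ_) (LP.length-++ (concat (toList t))))) ⟩
      suc (length q +ℕ (length (concat (toList t)) +ℕ length p))
        ≡⟨ cong (λ m → suc (length q +ℕ (m +ℕ length p))) et ⟩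
      suc (length q +ℕ (n +ℕ length p))
        ≡⟨ sym (length-split p a q n) ⟩
      length (p ++ a ∷ q) +ℕ n
        ∎)
      where open ≡-Reasoning

  rotationTerm : ℕ → ℕ → Word → List Sym → ℚ
  rotationTerm n k w R = χᶻ n (drop k R) * yzCoeff w (take k R)

  rotationTerm-++ : (n : ℕ) {k : ℕ} (w : Word) (R₁ R₂ : List Sym) → length R₁ ≡ k →
    rotationTerm n k w (R₁ ++ R₂) ≡ χᶻ n R₂ * yzCoeff w R₁
  rotationTerm-++ n w R₁ R₂ e = cong₂ (λ A B → χᶻ n A * yzCoeff w B) (drop-++-exact R₁ R₂ e) (take-++-exact R₁ R₂ e)

  rotationSum : ℕ → ℕ → Word → List Sym → ℚ
  rotationSum n k w V = ∑< (n +ℕ k) (λ i → rotationTerm n k w (rotate (suc i) (sy ∷ V)))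

  -- For i < n, the letter sy lands among the last n letters of the rotation.
  rotationTerm-vanishes : (n k : ℕ) (w : Word) (V : List Sym) → suc (length V) ≡ k +ℕ n →
    (i : ℕ) → i < n → rotationTerm n k w (rotate (suc i) (sy ∷ V)) ≡ 0ℚ
  rotationTerm-vanishes n k w V e i i<n with ℕP.m≤n⇒∃[o]m+o≡n i<n
  ... | t , refl with splitAt-length V i (k +ℕ t) lenV
    where
    lenV : length V ≡ i +ℕ (k +ℕ t)
    lenV = ℕP.suc-injective (trans e (trans (ℕP.+-suc k (i +ℕ t)) (cong suc
      (trans (sym (ℕP.+-assoc k i t)) (trans (cong (_+ℕ t) (ℕP.+-comm k i)) (ℕP.+-assoc i k t))))))
  ... | A , B , refl , eA , eB with splitAt-length B k t eB
  ... | B₁ , B₂ , refl , eB₁ , _ = begin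
    rotationTerm n k w (rotate (suc i) (sy ∷ A ++ B₁ ++ B₂))
      ≡⟨ cong (rotationTerm n k w) (trans (rotate-∷-++ sy A (B₁ ++ B₂) eA) (LP.++-assoc B₁ B₂ (sy ∷ A))) ⟩
    rotationTerm n k w (B₁ ++ B₂ ++ sy ∷ A)     ≡⟨ rotationTerm-++ n w B₁ (B₂ ++ sy ∷ A) eB₁ ⟩
    χᶻ n (B₂ ++ sy ∷ A) * yzCoeff w B₁          ≡⟨ cong (_* yzCoeff w B₁) (χᶻ-sy n B₂ A) ⟩
    0ℚ * yzCoeff w B₁                           ≡⟨ ℚP.*-zeroˡ (yzCoeff w B₁) ⟩
    0ℚ                                          ∎
    where open ≡-Reasoning

  -- The rotation by n + m + 1 ends with the n letters of V after position m.
  rotationTerm≡splitTerm : (n k : ℕ) (w : Word) (V : List Sym) → suc (length V) ≡ k +ℕ n →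
    (m : ℕ) → m < k → rotationTerm n k w (rotate (suc (n +ℕ m)) (sy ∷ V)) ≡ splitTerm n w V m
  rotationTerm≡splitTerm n k w V e m m<k with ℕP.m≤n⇒∃[o]m+o≡n m<k
  ... | t , refl with splitAt-length V m (n +ℕ t) lenV
    where
    lenV : length V ≡ m +ℕ (n +ℕ t)
    lenV = ℕP.suc-injective (trans e (cong suc (trans (ℕP.+-assoc m t n) (cong (m +ℕ_) (ℕP.+-comm t n)))))
  ... | A₁ , A′ , refl , eA₁ , eA′ with splitAt-length A′ n t eA′
  ... | A₂ , A₃ , refl , eA₂ , eA₃ = begin
    rotationTerm n k w (rotate (suc (n +ℕ m)) (sy ∷ A₁ ++ A₂ ++ A₃))
      ≡⟨ cong (λ Z → rotationTerm n k w (rotate (suc (n +ℕ m)) (sy ∷ Z))) (sym (LP.++-assoc A₁ A₂ A₃)) ⟩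
    rotationTerm n k w (rotate (suc (n +ℕ m)) (sy ∷ (A₁ ++ A₂) ++ A₃))
      ≡⟨ cong (rotationTerm n k w) (trans (rotate-∷-++ sy (A₁ ++ A₂) A₃ lenA₁₂) (sym (LP.++-assoc A₃ (sy ∷ A₁) A₂))) ⟩
    rotationTerm n k w ((A₃ ++ sy ∷ A₁) ++ A₂)
      ≡⟨ rotationTerm-++ n w (A₃ ++ sy ∷ A₁) A₂ lenA₃₁ ⟩
    χᶻ n A₂ * yzCoeff w (A₃ ++ sy ∷ A₁)
      ≡⟨ sym (cong₂ (λ B C → χᶻ n B * yzCoeff w (C ++ sy ∷ A₁)) (take-++-exact A₂ A₃ eA₂) (drop-++-exact A₂ A₃ eA₂)) ⟩
    χᶻ n (take n (A₂ ++ A₃)) * yzCoeff w (drop n (A₂ ++ A₃) ++ sy ∷ A₁)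
      ≡⟨ sym (cong₂ (λ B C → χᶻ n (take n B) * yzCoeff w (drop n B ++ sy ∷ C))
           (drop-++-exact A₁ (A₂ ++ A₃) eA₁) (take-++-exact A₁ (A₂ ++ A₃) eA₁)) ⟩
    splitTerm n w (A₁ ++ A₂ ++ A₃) m
      ∎
    where
    open ≡-Reasoning
    lenA₁₂ : length (A₁ ++ A₂) ≡ n +ℕ m
    lenA₁₂ = trans (LP.length-++ A₁) (trans (cong₂ _+ℕ_ eA₁ eA₂) (ℕP.+-comm m n))
    lenA₃₁ : length (A₃ ++ sy ∷ A₁) ≡ suc (m +ℕ t)
    lenA₃₁ = trans (LP.length-++ A₃) (trans (cong₂ _+ℕ_ eA₃ (cong suc eA₁)) (trans (ℕP.+-suc t m) (cong suc (ℕP.+-comm t m))))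

  ∑-splitTerm : (n k : ℕ) (w : Word) (V : List Sym) → suc (length V) ≡ k +ℕ n →
    ∑< k (splitTerm n w V) ≡ rotationSum n k w V
  ∑-splitTerm n k w V e = sym (begin
    rotationSum n k w V                               ≡⟨ ∑<-+ℕ n k G ⟩
    ∑< n G + ∑< k (λ m → G (n +ℕ m))
      ≡⟨ cong₂ _+_ (∑<-zero n G (rotationTerm-vanishes n k w V e)) (∑<-cong k (rotationTerm≡splitTerm n k w V e)) ⟩
    0ℚ + ∑< k (splitTerm n w V)                       ≡⟨ ℚP.+-identityˡ _ ⟩
    ∑< k (splitTerm n w V)                            ∎)
    where
    open ≡-Reasoning
    G : ℕ → ℚ
    G i = rotationTerm n k w (rotate (suc i) (sy ∷ V))

  ∑-allSyms-rotationTerm : (n k : ℕ) (w : Word) (R : List Sym) → length w ≡ k → length R ≡ k +ℕ n →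
    ∑ (allSyms k) (λ u → yzCoeff w u * χˢ (u ++ replicate n sz) R) ≡ rotationTerm n k w R
  ∑-allSyms-rotationTerm n k w R ew eR with splitAt-length R k n eR
  ... | R₁ , R₂ , refl , e₁ , _ = begin
    ∑ (allSyms k) (λ u → yzCoeff w u * χˢ (u ++ zⁿ) (R₁ ++ R₂))
      ≡⟨ ∑-allSyms-single k R₁ e₁ _ off ⟩
    yzCoeff w R₁ * χˢ (R₁ ++ zⁿ) (R₁ ++ R₂)
      ≡⟨ cong (yzCoeff w R₁ *_) (sym (χˢ-++ R₁ zⁿ R₁ R₂ refl)) ⟩
    yzCoeff w R₁ * (χˢ R₁ R₁ * χˢ zⁿ R₂)
      ≡⟨ cong (λ c → yzCoeff w R₁ * (c * χˢ zⁿ R₂)) (χˢ-refl R₁) ⟩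
    yzCoeff w R₁ * (1ℚ * χˢ zⁿ R₂)
      ≡⟨ cong (yzCoeff w R₁ *_) (trans (ℚP.*-identityˡ _) (sym (χᶻ≡χˢ n R₂))) ⟩
    yzCoeff w R₁ * χᶻ n R₂
      ≡⟨ ℚP.*-comm (yzCoeff w R₁) (χᶻ n R₂) ⟩
    χᶻ n R₂ * yzCoeff w R₁
      ≡⟨ sym (rotationTerm-++ n w R₁ R₂ e₁) ⟩
    rotationTerm n k w (R₁ ++ R₂)
      ∎
    where
    open ≡-Reasoning
    zⁿ : List Sym
    zⁿ = replicate n sz
    off : ∀ u → ¬ (u ≡ R₁) → yzCoeff w u * χˢ (u ++ zⁿ) (R₁ ++ R₂) ≡ 0ℚ
    off u ne with length w ℕP.≟ length u
    ... | no ne′ = trans (cong (_* _) (yzCoeff-length w u ne′)) (ℚP.*-zeroˡ (χˢ (u ++ zⁿ) (R₁ ++ R₂)))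
    ... | yes e′ = trans (cong (yzCoeff w u *_) (χ-no (_ ≟Ss _) (λ e″ → ne (trans
                    (sym (take-++-exact u zⁿ (trans (sym e′) ew))) (trans (cong (take k) e″) (take-++-exact R₁ R₂ e₁))))))
                   (ℚP.*-zeroʳ (yzCoeff w u))

  rotationSum-via-rotationCount : (n k : ℕ) (w : Word) (V : List Sym) → length w ≡ k → suc (length V) ≡ k +ℕ n →
    rotationSum n k w V ≡ ∑ (allSyms k) (λ u → yzCoeff w u * rotationCount (n +ℕ k) (sy ∷ V) (u ++ replicate n sz))
  rotationSum-via-rotationCount n k w V ew eV = sym (begin
    ∑ (allSyms k) (λ u → yzCoeff w u * rotationCount (n +ℕ k) (sy ∷ V) (u ++ replicate n sz))
      ≡⟨ ∑-cong (allSyms k) (λ u → sym (∑<-* (n +ℕ k) (yzCoeff w u) _)) ⟩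
    ∑ (allSyms k) (λ u → ∑< (n +ℕ k) (λ i → yzCoeff w u * χˢ (u ++ replicate n sz) (R i)))
      ≡⟨ ∑-∑<-swap (allSyms k) (n +ℕ k) _ ⟩
    ∑< (n +ℕ k) (λ i → ∑ (allSyms k) (λ u → yzCoeff w u * χˢ (u ++ replicate n sz) (R i)))
      ≡⟨ ∑<-cong (n +ℕ k) (λ i _ → ∑-allSyms-rotationTerm n k w (R i) ew (trans (length-rotate (suc i) (sy ∷ V)) eV)) ⟩
    rotationSum n k w V
      ∎)
    where
    open ≡-Reasoning
    R : ℕ → List Sym
    R i = rotate (suc i) (sy ∷ V)

  ∑-expand-rotationSum : (n k : ℕ) (u V : List Sym) → length u ≡ k → suc (length V) ≡ k +ℕ n →
    ∑ (expand u) (λ w → rotationSum n k w V) ≡ rotationCount (n +ℕ k) (sy ∷ V) (u ++ replicate n sz)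
  ∑-expand-rotationSum n k u V eu eV = trans (∑-∑<-swap (expand u) (n +ℕ k) _)
    (∑<-cong (n +ℕ k) (λ i _ → pointwise (rotate (suc i) (sy ∷ V)) (trans (length-rotate (suc i) (sy ∷ V)) eV)))
    where
    pointwise : (R : List Sym) → length R ≡ k +ℕ n → ∑ (expand u) (λ w → rotationTerm n k w R) ≡ χˢ (u ++ replicate n sz) R
    pointwise R eR with splitAt-length R k n eR
    ... | R₁ , R₂ , refl , e₁ , _ = begin
      ∑ (expand u) (λ w → rotationTerm n k w (R₁ ++ R₂))   ≡⟨ ∑-cong (expand u) (λ w → rotationTerm-++ n w R₁ R₂ e₁) ⟩
      ∑ (expand u) (λ w → χᶻ n R₂ * yzCoeff w R₁)          ≡⟨ ∑-* (expand u) (χᶻ n R₂) _ ⟩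
      χᶻ n R₂ * ∑ (expand u) (λ w → yzCoeff w R₁)          ≡⟨ cong₂ _*_ (χᶻ≡χˢ n R₂) (∑-expand-yzCoeff u R₁) ⟩
      χˢ (replicate n sz) R₂ * χˢ u R₁                     ≡⟨ ℚP.*-comm (χˢ (replicate n sz) R₂) (χˢ u R₁) ⟩
      χˢ u R₁ * χˢ (replicate n sz) R₂                     ≡⟨ χˢ-++ u (replicate n sz) R₁ R₂ (trans eu (sym e₁)) ⟩
      χˢ (u ++ replicate n sz) (R₁ ++ R₂)                  ∎
      where open ≡-Reasoning

module Orbits where

  open import Defs
  open Lists
  open ChangeOfBasis using (allSyms; _≟S_)
  open Rotations
  open import Data.Nat using (ℕ; zero; suc; _+_; _*_; _∸_; _≤_; _<_; _≤?_; z≤n; s≤s; NonZero; >-nonZero)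
  import Data.Nat.Properties as ℕP
  open import Data.Nat.DivMod using (_%_; _/_; m≡m%n+[m/n]*n; m%n<n)
  open import Data.List using (List; []; _∷_; _++_; map; length; take; drop; replicate; filter)
  import Data.List.Properties as LP
  open import Data.List.Membership.Propositional using (_∈_)
  open import Data.List.Membership.Propositional.Properties using (∈-filter⁺; ∈-lookup)
  import Data.List as List
  open import Data.List.Relation.Unary.All using (All; []; _∷_)
  import Data.List.Relation.Unary.All as All
  import Data.List.Relation.Unary.All.Properties as AllP
  open import Data.List.Relation.Unary.Any using (Any; here; there)
  import Data.List.Relation.Unary.Any as Any
  import Data.List.Relation.Unary.Any.Properties as AnyP
  open import Data.List.Relation.Unary.AllPairs using (AllPairs; []; _∷_)
  import Data.List.Relation.Unary.AllPairs.Properties as PairsP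
  open import Data.Vec using (Vec; toList; lookup) renaming ([] to []ᵥ; _∷_ to _∷ᵥ_)
  import Data.Vec as Vec
  import Data.Vec.Properties as VP
  open import Data.Fin using (Fin; toℕ; fromℕ<) renaming (zero to fz; suc to fs)
  import Data.Fin.Properties as FP
  open import Data.Product using (Σ; ∃; _×_; _,_; proj₁; proj₂)
  open import Relation.Nullary using (¬_; Dec; yes; no)
  open import Relation.Binary.PropositionalEquality

  #y : List Sym → ℕ
  #y [] = 0
  #y (sy ∷ l) = suc (#y l)
  #y (sz ∷ l) = #y l

  #y-++ : (l m : List Sym) → #y (l ++ m) ≡ #y l + #y m
  #y-++ [] m = refl
  #y-++ (sy ∷ l) m = cong suc (#y-++ l m)
  #y-++ (sz ∷ l) m = #y-++ l m

  #y-zs : (t : ℕ) → #y (replicate t sz) ≡ 0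
  #y-zs zero = refl
  #y-zs (suc t) = #y-zs t

  #y-rotate : (j : ℕ) (l : List Sym) → #y (rotate j l) ≡ #y l
  #y-rotate zero l = refl
  #y-rotate (suc j) [] = refl
  #y-rotate (suc j) (a ∷ l) = trans (#y-rotate j (l ++ a ∷ [])) (trans (#y-++ l (a ∷ [])) (last a))
    where
    last : (a : Sym) → #y l + #y (a ∷ []) ≡ #y (a ∷ l)
    last sy = ℕP.+-comm (#y l) 1
    last sz = ℕP.+-identityʳ (#y l)

  #y≡0 : (l : List Sym) → #y l ≡ 0 → l ≡ replicate (length l) sz
  #y≡0 [] e = refl
  #y≡0 (sz ∷ l) e = cong (sz ∷_) (#y≡0 l e)

  last-y : (l : List Sym) → 0 < #y l → Σ (List Sym) λ b → Σ ℕ λ t → l ≡ b ++ sy ∷ replicate t sz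
  last-y (sz ∷ l) p with last-y l p
  ... | b , t , e = sz ∷ b , t , cong (sz ∷_) e
  last-y (sy ∷ l) p with #y l ℕP.≟ 0
  ... | yes e = [] , length l , cong (sy ∷_) (#y≡0 l e)
  ... | no ne with last-y l (ℕP.n≢0⇒n>0 ne)
  ... | b , t , e = sy ∷ b , t , cong (sy ∷_) e

  allSyms-length : (m : ℕ) → All (λ u → length u ≡ m) (allSyms m)
  allSyms-length zero = refl ∷ []
  allSyms-length (suc m) = AllP.++⁺ (AllP.map⁺ (All.map (cong suc) (allSyms-length m)))
                                    (AllP.map⁺ (All.map (cong suc) (allSyms-length m)))

  ∈-allSyms : (m : ℕ) (u : List Sym) → length u ≡ m → u ∈ allSyms m
  ∈-allSyms zero [] e = here refl
  ∈-allSyms (suc m) (sy ∷ u) e =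
    AnyP.++⁺ˡ (AnyP.map⁺ (Any.map (cong (sy ∷_)) (∈-allSyms m u (ℕP.suc-injective e))))
  ∈-allSyms (suc m) (sz ∷ u) e =
    AnyP.++⁺ʳ (map (sy ∷_) (allSyms m)) (AnyP.map⁺ (Any.map (cong (sz ∷_)) (∈-allSyms m u (ℕP.suc-injective e))))

  -- the vector with entries l, padded with z's (only used when length l ≡ m)
  toVec : (m : ℕ) → List Sym → Vec Sym m
  toVec zero _ = []ᵥ
  toVec (suc m) [] = sz ∷ᵥ toVec m []
  toVec (suc m) (a ∷ l) = a ∷ᵥ toVec m l

  toList-toVec : (m : ℕ) (l : List Sym) → length l ≡ m → toList (toVec m l) ≡ l
  toList-toVec zero [] e = refl
  toList-toVec (suc m) (a ∷ l) e = cong (a ∷_) (toList-toVec m l (ℕP.suc-injective e))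

  toList-injective : {m : ℕ} (u v : Vec Sym m) → toList u ≡ toList v → u ≡ v
  toList-injective []ᵥ []ᵥ e = refl
  toList-injective (a ∷ᵥ u) (b ∷ᵥ v) e = cong₂ _∷ᵥ_ (LP.∷-injectiveˡ e) (toList-injective u v (LP.∷-injectiveʳ e))

  take-zs⇒lookup : {m : ℕ} (v : Vec Sym m) (n : ℕ) → take n (toList v) ≡ replicate n sz →
    ∀ (i : Fin m) → toℕ i < n → lookup v i ≡ sz
  take-zs⇒lookup (a ∷ᵥ v) (suc n) e fz lt = LP.∷-injectiveˡ e
  take-zs⇒lookup (a ∷ᵥ v) (suc n) e (fs i) (s≤s lt) = take-zs⇒lookup v n (LP.∷-injectiveʳ e) i lt

  lookup⇒take-zs : {m : ℕ} (v : Vec Sym m) (n : ℕ) → n ≤ m → (∀ (i : Fin m) → toℕ i < n → lookup v i ≡ sz) →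
    take n (toList v) ≡ replicate n sz
  lookup⇒take-zs v zero le h = refl
  lookup⇒take-zs (a ∷ᵥ v) (suc n) (s≤s le) h = cong₂ _∷_ (h fz (s≤s z≤n)) (lookup⇒take-zs v n le (λ i lt → h (fs i) (s≤s lt)))

  zs-++ : (a b : ℕ) → replicate a sz ++ replicate b sz ≡ replicate (a + b) sz
  zs-++ zero b = refl
  zs-++ (suc a) b = cong (sz ∷_) (zs-++ a b)

  zs-++-comm : (a b : ℕ) → replicate a sz ++ replicate b sz ≡ replicate b sz ++ replicate a sz
  zs-++-comm a b = trans (zs-++ a b) (trans (cong (λ m → replicate m sz) (ℕP.+-comm a b)) (sym (zs-++ b a)))

  AllPairs-lookup : {A : Set} {R : A → A → Set} → (∀ {a b} → R a b → R b a) → (l : List A) → AllPairs R l →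
    (i j : Fin (length l)) → ¬ (i ≡ j) → R (List.lookup l i) (List.lookup l j)
  AllPairs-lookup sym-R (a ∷ l) (p ∷ ps) fz fz ne with () ← ne refl
  AllPairs-lookup sym-R (a ∷ l) (p ∷ ps) fz (fs j) ne = All.lookup p (∈-lookup j)
  AllPairs-lookup sym-R (a ∷ l) (p ∷ ps) (fs i) fz ne = sym-R (All.lookup p (∈-lookup i))
  AllPairs-lookup sym-R (a ∷ l) (p ∷ ps) (fs i) (fs j) ne = AllPairs-lookup sym-R l ps i j (λ e → ne (cong fs e))

  module _ {L : ℕ} where

    CycEq⇒rotate : (u v : Vec Sym L) → CycEq u v → Σ ℕ λ j → rotate j (toList u) ≡ toList v
    CycEq⇒rotate u v (j , e) = j , trans (sym (toList-rot j u)) (cong toList e)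

    rotate⇒CycEq : (u v : Vec Sym L) (j : ℕ) → rotate j (toList u) ≡ toList v → CycEq u v
    rotate⇒CycEq u v j e = j , toList-injective (rot j u) v (trans (toList-rot j u) e)

    CycEq-refl : (u : Vec Sym L) → CycEq u u
    CycEq-refl u = 0 , refl

    CycEq-trans : (u v w : Vec Sym L) → CycEq u v → CycEq v w → CycEq u w
    CycEq-trans u v w (i , e₁) (j , e₂) = i + j , trans (rot-+ i j u) (trans (cong (rot j) e₁) e₂)
      where
      rot-+ : (i j : ℕ) (u : Vec Sym L) → rot (i + j) u ≡ rot j (rot i u)
      rot-+ zero j u = refl
      rot-+ (suc i) j u = rot-+ i j (rot1 u)

    CycEq-#y : (u v : Vec Sym L) → CycEq u v → #y (toList u) ≡ #y (toList v)
    CycEq-#y u v c with CycEq⇒rotate u v c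
    ... | j , e = trans (sym (#y-rotate j (toList u))) (cong #y e)

    rotate-mod : {{_ : NonZero L}} (l : List Sym) → length l ≡ L → (j : ℕ) → rotate j l ≡ rotate (j % L) l
    rotate-mod l e j = begin
      rotate j l                                ≡⟨ cong (λ m → rotate m l) (m≡m%n+[m/n]*n j L) ⟩
      rotate (j % L + (j / L) * L) l            ≡⟨ rotate-+ (j % L) _ l ⟩
      rotate ((j / L) * L) (rotate (j % L) l)   ≡⟨ periods (j / L) (rotate (j % L) l) (trans (length-rotate (j % L) l) e) ⟩
      rotate (j % L) l                          ∎
      where
      open ≡-Reasoning
      periods : (q : ℕ) (l : List Sym) → length l ≡ L → rotate (q * L) l ≡ l
      periods zero l e = refl
      periods (suc q) l e = trans (rotate-period l e (q * L)) (periods q l e)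

    CycEq-sym : {{_ : NonZero L}} (u v : Vec Sym L) → CycEq u v → CycEq v u
    CycEq-sym u v c with CycEq⇒rotate u v c
    ... | j , e = rotate⇒CycEq v u (L ∸ j % L) (begin
      rotate (L ∸ j % L) (toList v)                      ≡⟨ cong (rotate (L ∸ j % L)) (sym e) ⟩
      rotate (L ∸ j % L) (rotate j (toList u))           ≡⟨ cong (rotate (L ∸ j % L)) (rotate-mod (toList u) lenU j) ⟩
      rotate (L ∸ j % L) (rotate (j % L) (toList u))     ≡⟨ sym (rotate-+ (j % L) (L ∸ j % L) (toList u)) ⟩
      rotate (j % L + (L ∸ j % L)) (toList u)
        ≡⟨ cong (λ m → rotate m (toList u)) (ℕP.m+[n∸m]≡n (ℕP.<⇒≤ (m%n<n j L))) ⟩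
      rotate L (toList u)                                ≡⟨ subst (λ m → rotate m (toList u) ≡ toList u) lenU (rotate-length (toList u)) ⟩
      toList u                                           ∎)
      where
      open ≡-Reasoning
      lenU : length (toList u) ≡ L
      lenU = VP.length-toList u

    CycEq? : {{_ : NonZero L}} (u v : Vec Sym L) → Dec (CycEq u v)
    CycEq? u v with FP.any? (λ (i : Fin L) → VP.≡-dec _≟S_ (rot (toℕ i) u) v)
    ... | yes (i , e) = yes (toℕ i , e)
    ... | no none = no λ c → none (reduce c)
      where
      reduce : CycEq u v → ∃ λ (i : Fin L) → rot (toℕ i) u ≡ v
      reduce c with CycEq⇒rotate u v c
      ... | j , e = fromℕ< (m%n<n j L) , toList-injective _ v (begin
        toList (rot (toℕ (fromℕ< (m%n<n j L))) u)   ≡⟨ cong (λ m → toList (rot m u)) (FP.toℕ-fromℕ< (m%n<n j L)) ⟩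
        toList (rot (j % L) u)                      ≡⟨ toList-rot (j % L) u ⟩
        rotate (j % L) (toList u)                   ≡⟨ sym (rotate-mod (toList u) (VP.length-toList u) j) ⟩
        rotate j (toList u)                         ≡⟨ e ⟩
        toList v                                    ∎)
        where open ≡-Reasoning

  module Representatives (n k′ : ℕ) where

    L : ℕ
    L = n + suc k′

    instance
      L-nonZero : NonZero L
      L-nonZero = >-nonZero (subst (0 <_) (sym (ℕP.+-suc n k′)) (s≤s z≤n))

    zⁿ : List Sym
    zⁿ = replicate n sz

    -- Every class of X_{L,n} but that of z^L contains a tuple a y zⁿ.
    rep : List Sym → List Sym
    rep a = a ++ sy ∷ zⁿ

    length-rep : (a : List Sym) → length a ≡ k′ → length (rep a) ≡ L
    length-rep a e = begin
      length (a ++ sy ∷ zⁿ)          ≡⟨ LP.length-++ a ⟩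
      length a + suc (length zⁿ)     ≡⟨ cong₂ (λ p q → p + suc q) e (LP.length-replicate n) ⟩
      k′ + suc n                     ≡⟨ ℕP.+-suc k′ n ⟩
      suc (k′ + n)                   ≡⟨ cong suc (ℕP.+-comm k′ n) ⟩
      suc (n + k′)                   ≡⟨ sym (ℕP.+-suc n k′) ⟩
      L                              ∎
      where open ≡-Reasoning

    repVec : List Sym → Vec Sym L
    repVec a = toVec L (rep a)

    toList-repVec : (a : List Sym) → length a ≡ k′ → toList (repVec a) ≡ rep a
    toList-repVec a e = toList-toVec L (rep a) (length-rep a e)

    #y-rep : (a : List Sym) → #y (rep a) ≡ suc (#y a)
    #y-rep a = trans (#y-++ a (sy ∷ zⁿ)) (trans (cong (λ m → #y a + suc m) (#y-zs n)) (ℕP.+-comm (#y a) 1))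

    zVec : Vec Sym L
    zVec = Vec.replicate L sz

    a₀ : List Sym
    a₀ = replicate k′ sz

    dedup : List (List Sym) → List (List Sym)
    dedup [] = []
    dedup (a ∷ l) with Any.any? (λ b → CycEq? (repVec a) (repVec b)) (dedup l)
    ... | yes _ = dedup l
    ... | no _ = a ∷ dedup l

    dedup-All : {P : List Sym → Set} (l : List (List Sym)) → All P l → All P (dedup l)
    dedup-All [] [] = []
    dedup-All (a ∷ l) (p ∷ ps) with Any.any? (λ b → CycEq? (repVec a) (repVec b)) (dedup l)
    ... | yes _ = dedup-All l ps
    ... | no _ = p ∷ dedup-All l ps

    dedup-pairwise : (l : List (List Sym)) → AllPairs (λ a b → ¬ CycEq (repVec a) (repVec b)) (dedup l)
    dedup-pairwise [] = []
    dedup-pairwise (a ∷ l) with Any.any? (λ b → CycEq? (repVec a) (repVec b)) (dedup l)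
    ... | yes _ = dedup-pairwise l
    ... | no h = AllP.¬Any⇒All¬ (dedup l) h ∷ dedup-pairwise l

    dedup-covers : (l : List (List Sym)) (b : List Sym) → b ∈ l → Any (λ c → CycEq (repVec b) (repVec c)) (dedup l)
    dedup-covers (a ∷ l) b (here refl) with Any.any? (λ b → CycEq? (repVec a) (repVec b)) (dedup l)
    ... | yes h = h
    ... | no _ = here (CycEq-refl (repVec a))
    dedup-covers (a ∷ l) b (there p) with Any.any? (λ b → CycEq? (repVec a) (repVec b)) (dedup l)
    ... | yes _ = dedup-covers l b p
    ... | no _ = there (dedup-covers l b p)

    hasY? : (a : List Sym) → Dec (0 < #y a)
    hasY? a = 1 ≤? #y a

    -- one a per class of tuples with at least two y's
    basisWords : List (List Sym)
    basisWords = dedup (filter hasY? (allSyms k′))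

    basisWords-props : All (λ a → length a ≡ k′ × 0 < #y a) basisWords
    basisWords-props = dedup-All _ (All.zip (AllP.filter⁺ hasY? (allSyms-length k′) , AllP.all-filter hasY? (allSyms k′)))

    representatives : List (Vec Sym L)
    representatives = zVec ∷ repVec a₀ ∷ map repVec basisWords

    InX-repVec : (a : List Sym) → length a ≡ k′ → InX L n (repVec a)
    InX-repVec a e = suc k′ , take-zs⇒lookup (rot (suc k′) (repVec a)) n (begin
      take n (toList (rot (suc k′) (repVec a)))   ≡⟨ cong (take n) (toList-rot (suc k′) (repVec a)) ⟩
      take n (rotate (suc k′) (toList (repVec a))) ≡⟨ cong (λ l → take n (rotate (suc k′) l)) (toList-repVec a e) ⟩
      take n (rotate (suc k′) (a ++ sy ∷ zⁿ))     ≡⟨ cong (λ l → take n (rotate (suc k′) l)) (sym (LP.++-assoc a (sy ∷ []) zⁿ)) ⟩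
      take n (rotate (suc k′) ((a ++ sy ∷ []) ++ zⁿ))
        ≡⟨ cong (take n) (rotate-++-exact (a ++ sy ∷ []) zⁿ (trans (length-∷ʳ a sy) (cong suc e))) ⟩
      take n (zⁿ ++ a ++ sy ∷ [])                 ≡⟨ take-++-exact zⁿ (a ++ sy ∷ []) (LP.length-replicate n) ⟩
      zⁿ                                          ∎)
      where open ≡-Reasoning

    InX-zVec : InX L n zVec
    InX-zVec = 0 , λ i _ → VP.lookup-replicate i sz

    #y-zVec : #y (toList zVec) ≡ 0
    #y-zVec = trans (cong #y (VP.toList-replicate L sz)) (#y-zs L)

    #y-repVec : (a : List Sym) → length a ≡ k′ → #y (toList (repVec a)) ≡ suc (#y a)
    #y-repVec a e = trans (cong #y (toList-repVec a e)) (#y-rep a)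

    #y-repVec-a₀ : #y (toList (repVec a₀)) ≡ 1
    #y-repVec-a₀ = trans (#y-repVec a₀ (LP.length-replicate k′)) (cong suc (#y-zs k′))

    representatives-InX : All (InX L n) representatives
    representatives-InX = InX-zVec ∷ InX-repVec a₀ (LP.length-replicate k′)
      ∷ AllP.map⁺ (All.map (λ p → InX-repVec _ (proj₁ p)) basisWords-props)

    -- Cyclically equivalent tuples have the same number of y's: 0, 1 and at least 2 separate the three kinds.
    representatives-distinct : AllPairs (λ u v → ¬ CycEq u v) representatives
    representatives-distinct =
        ( (λ c → 0≢1+n (trans (sym #y-zVec) (trans (CycEq-#y _ _ c) #y-repVec-a₀)))
        ∷ AllP.map⁺ (All.map (λ {a} p c → 0≢1+n (trans (sym #y-zVec) (trans (CycEq-#y _ _ c) (#y-repVec a (proj₁ p)))))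
                      basisWords-props))
      ∷ AllP.map⁺ (All.map (λ {a} p c → 1+n≢1 (proj₂ p) (trans (sym (#y-repVec a (proj₁ p)))
                               (trans (sym (CycEq-#y _ _ c)) #y-repVec-a₀))) basisWords-props)
      ∷ PairsP.map⁺ (dedup-pairwise (filter hasY? (allSyms k′)))
      where
      0≢1+n : {m : ℕ} → ¬ (0 ≡ suc m)
      0≢1+n ()
      1+n≢1 : {m : ℕ} → 0 < m → ¬ (suc m ≡ 1)
      1+n≢1 (s≤s _) ()

    -- From a block zⁿ starting at position j, the last y of U before it gives the tuple a y zⁿ.
    rotate-to-rep : (U : List Sym) → length U ≡ L → 0 < #y U → (j : ℕ) → take n (rotate j U) ≡ zⁿ →
      Σ ℕ λ j′ → Σ (List Sym) λ a → length a ≡ k′ × rotate j′ U ≡ rep a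
    rotate-to-rep U eU hasY j ej with last-y (drop n (rotate j U)) #y-tail
      where
      #y-tail : 0 < #y (drop n (rotate j U))
      #y-tail = subst (0 <_) (begin
        #y U                                                   ≡⟨ sym (#y-rotate j U) ⟩
        #y (rotate j U)                                        ≡⟨ cong #y (sym (LP.take++drop≡id n (rotate j U))) ⟩
        #y (take n (rotate j U) ++ drop n (rotate j U))        ≡⟨ #y-++ (take n (rotate j U)) _ ⟩
        #y (take n (rotate j U)) + #y (drop n (rotate j U))    ≡⟨ cong (λ l → #y l + #y (drop n (rotate j U))) ej ⟩
        #y zⁿ + #y (drop n (rotate j U))                       ≡⟨ cong (_+ #y (drop n (rotate j U))) (#y-zs n) ⟩
        #y (drop n (rotate j U))                               ∎) hasY
        where open ≡-Reasoning
    ... | b , t , eb = j + (length P + n) , zᵗ ++ b , length-a , rotated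
      where
      open ≡-Reasoning
      zᵗ : List Sym
      zᵗ = replicate t sz
      P : List Sym
      P = zⁿ ++ b ++ sy ∷ []
      W-split : rotate j U ≡ P ++ zᵗ
      W-split = begin
        rotate j U                                     ≡⟨ sym (LP.take++drop≡id n (rotate j U)) ⟩
        take n (rotate j U) ++ drop n (rotate j U)     ≡⟨ cong₂ _++_ ej eb ⟩
        zⁿ ++ b ++ sy ∷ zᵗ                             ≡⟨ cong (zⁿ ++_) (sym (LP.++-assoc b (sy ∷ []) zᵗ)) ⟩
        zⁿ ++ (b ++ sy ∷ []) ++ zᵗ                     ≡⟨ sym (LP.++-assoc zⁿ (b ++ sy ∷ []) zᵗ) ⟩
        P ++ zᵗ                                        ∎
      rotated : rotate (j + (length P + n)) U ≡ rep (zᵗ ++ b)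
      rotated = begin
        rotate (j + (length P + n)) U                  ≡⟨ rotate-+ j (length P + n) U ⟩
        rotate (length P + n) (rotate j U)             ≡⟨ rotate-+ (length P) n (rotate j U) ⟩
        rotate n (rotate (length P) (rotate j U))      ≡⟨ cong (λ l → rotate n (rotate (length P) l)) W-split ⟩
        rotate n (rotate (length P) (P ++ zᵗ))         ≡⟨ cong (rotate n) (rotate-++ P zᵗ) ⟩
        rotate n (zᵗ ++ zⁿ ++ b ++ sy ∷ [])            ≡⟨ cong (rotate n) (sym (LP.++-assoc zᵗ zⁿ (b ++ sy ∷ []))) ⟩
        rotate n ((zᵗ ++ zⁿ) ++ b ++ sy ∷ [])          ≡⟨ cong (λ l → rotate n (l ++ b ++ sy ∷ [])) (zs-++-comm t n) ⟩
        rotate n ((zⁿ ++ zᵗ) ++ b ++ sy ∷ [])          ≡⟨ cong (rotate n) (LP.++-assoc zⁿ zᵗ (b ++ sy ∷ [])) ⟩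
        rotate n (zⁿ ++ zᵗ ++ b ++ sy ∷ [])            ≡⟨ rotate-++-exact zⁿ (zᵗ ++ b ++ sy ∷ []) (LP.length-replicate n) ⟩
        (zᵗ ++ b ++ sy ∷ []) ++ zⁿ                     ≡⟨ cong (_++ zⁿ) (sym (LP.++-assoc zᵗ b (sy ∷ []))) ⟩
        ((zᵗ ++ b) ++ sy ∷ []) ++ zⁿ                   ≡⟨ LP.++-assoc (zᵗ ++ b) (sy ∷ []) zⁿ ⟩
        rep (zᵗ ++ b)                                  ∎
      length-a : length (zᵗ ++ b) ≡ k′
      length-a = ℕP.+-cancelˡ-≡ n _ _ (ℕP.suc-injective (begin
        suc (n + length (zᵗ ++ b))                     ≡⟨ cong suc (ℕP.+-comm n _) ⟩
        suc (length (zᵗ ++ b) + n)                     ≡⟨ sym (ℕP.+-suc _ n) ⟩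
        length (zᵗ ++ b) + suc n                       ≡⟨ cong (λ m → length (zᵗ ++ b) + suc m) (sym (LP.length-replicate n)) ⟩
        length (zᵗ ++ b) + length (sy ∷ zⁿ)            ≡⟨ sym (LP.length-++ (zᵗ ++ b)) ⟩
        length (rep (zᵗ ++ b))                         ≡⟨ cong length (sym rotated) ⟩
        length (rotate (j + (length P + n)) U)         ≡⟨ length-rotate (j + (length P + n)) U ⟩
        length U                                       ≡⟨ eU ⟩
        n + suc k′                                     ≡⟨ ℕP.+-suc n k′ ⟩
        suc (n + k′)                                   ∎))

    representatives-cover : ∀ u → InX L n u → Any (CycEq u) representatives
    representatives-cover u (j , h) with #y (toList u) ℕP.≟ 0
    ... | yes e = here (subst (CycEq u) (toList-injective u zVec (begin
      toList u                                       ≡⟨ #y≡0 (toList u) e ⟩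
      replicate (length (toList u)) sz               ≡⟨ cong (λ m → replicate m sz) (VP.length-toList u) ⟩
      replicate L sz                                 ≡⟨ sym (VP.toList-replicate L sz) ⟩
      toList zVec                                    ∎)) (CycEq-refl u))
      where open ≡-Reasoning
    ... | no ne with rotate-to-rep (toList u) (VP.length-toList u) (ℕP.n≢0⇒n>0 ne) j
                       (trans (cong (take n) (sym (toList-rot j u))) (lookup⇒take-zs (rot j u) n (ℕP.m≤m+n n (suc k′)) h))
    ... | j′ , a , ea , e with #y a ℕP.≟ 0
    ... | yes e₀ = there (here (rotate⇒CycEq u (repVec a₀) j′ (trans e (trans
          (cong rep (trans (#y≡0 a e₀) (cong (λ m → replicate m sz) ea))) (sym (toList-repVec a₀ (LP.length-replicate k′)))))))
    ... | no ne′ = there (there (AnyP.map⁺ (Any.map (λ {c} → CycEq-trans u (repVec a) (repVec c) u~a)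
          (dedup-covers _ a (∈-filter⁺ hasY? (∈-allSyms k′ a ea) (ℕP.n≢0⇒n>0 ne′))))))
      where
      u~a : CycEq u (repVec a)
      u~a = rotate⇒CycEq u (repVec a) j′ (trans e (sym (toList-repVec a ea)))

    numY : NumY L n (suc (suc (length basisWords)))
    numY = representatives , (representatives-InX , representatives-cover , representatives-distinct)
      , cong (λ m → suc (suc m)) (LP.length-map repVec basisWords)

    word : Fin (length basisWords) → List Sym
    word i = List.lookup basisWords i

    word-props : (i : Fin (length basisWords)) → length (word i) ≡ k′ × 0 < #y (word i)
    word-props i = All.lookup basisWords-props (∈-lookup i)

    words-distinct : (i j : Fin (length basisWords)) → ¬ (i ≡ j) → ¬ CycEq (repVec (word i)) (repVec (word j))
    words-distinct = AllPairs-lookup (λ nc c → nc (CycEq-sym _ _ c)) basisWords (dedup-pairwise (filter hasY? (allSyms k′)))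

module Admissible where

  open import Defs
  open Sums
  open Lists
  open ChangeOfBasis
  open import Data.Nat using (ℕ; zero; suc; _+_; _≤_; _∸_; z≤n; s≤s)
  import Data.Nat.Properties as ℕP
  open import Data.Nat.ListAction using (sum)
  open import Data.Rational using (ℚ; 0ℚ; 1ℚ; -_; _*_) renaming (_+_ to _+ℚ_)
  import Data.Rational.Properties as ℚP
  open import Data.Rational.Solver using (module +-*-Solver)
  open import Data.List using (List; []; _∷_; _++_; map; concatMap; length; replicate)
  import Data.List.Properties as LP
  open import Data.List.Membership.Propositional using (_∈_)
  open import Data.List.Relation.Unary.All using (All; []; _∷_)
  import Data.List.Relation.Unary.All as All
  import Data.List.Relation.Unary.All.Properties as AllP
  open import Data.List.Relation.Unary.Any using (Any; here; there)
  import Data.List.Relation.Unary.Any.Properties as AnyP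
  open import Data.Product using (Σ; _×_; _,_)
  open import Data.Sum using (_⊎_; inj₁; inj₂)
  open import Relation.Nullary using (¬_)
  open import Relation.Binary.PropositionalEquality
  open +-*-Solver

  -- The sum of all yz-coefficients of w is its value at y = z = 1, where x = z - y vanishes.
  ∑-yzCoeff-x∈ : (m : ℕ) (w : Word) → x ∈ w → ∑ (allSyms m) (yzCoeff w) ≡ 0ℚ
  ∑-yzCoeff-x∈ zero (a ∷ w) _ = refl
  ∑-yzCoeff-x∈ (suc m) (a ∷ w) x∈ = begin
    ∑ (allSyms (suc m)) (yzCoeff (a ∷ w))
      ≡⟨ ∑-allSyms-suc m _ ⟩
    ∑ (allSyms m) (λ u → yzCoeffˡ a sy * yzCoeff w u) +ℚ ∑ (allSyms m) (λ u → yzCoeffˡ a sz * yzCoeff w u)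
      ≡⟨ cong₂ _+ℚ_ (∑-* (allSyms m) (yzCoeffˡ a sy) (yzCoeff w)) (∑-* (allSyms m) (yzCoeffˡ a sz) (yzCoeff w)) ⟩
    yzCoeffˡ a sy * S +ℚ yzCoeffˡ a sz * S
      ≡⟨ cases a x∈ ⟩
    0ℚ ∎
    where
    open ≡-Reasoning
    S : ℚ
    S = ∑ (allSyms m) (yzCoeff w)
    cases : (a : Letter) → x ∈ a ∷ w → yzCoeffˡ a sy * S +ℚ yzCoeffˡ a sz * S ≡ 0ℚ
    cases x _ = solve 1 (λ s → (:- con 1ℚ) :* s :+ con 1ℚ :* s := con 0ℚ) refl S
    cases y (there x∈w) = trans (cong (λ s → 1ℚ * s +ℚ 0ℚ * s) (∑-yzCoeff-x∈ m w x∈w)) refl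

  yzCoeff-zs-y∈ : (m : ℕ) (w : Word) → y ∈ w → yzCoeff w (replicate m sz) ≡ 0ℚ
  yzCoeff-zs-y∈ zero (a ∷ w) _ = refl
  yzCoeff-zs-y∈ (suc m) (y ∷ w) (here refl) = ℚP.*-zeroˡ (yzCoeff w (replicate m sz))
  yzCoeff-zs-y∈ (suc m) (a ∷ w) (there y∈w) =
    trans (cong (yzCoeffˡ a sz *_) (yzCoeff-zs-y∈ m w y∈w)) (ℚP.*-zeroʳ (yzCoeffˡ a sz))

  length-zk : (m : ℕ) → 1 ≤ m → length (zk m) ≡ m
  length-zk (suc m) _ = trans (length-∷ʳ (replicate m x) y) (cong suc (LP.length-replicate m))

  length-concatMap-zk : (ks : List ℕ) → All (1 ≤_) ks → length (concatMap zk ks) ≡ sum ks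
  length-concatMap-zk [] [] = refl
  length-concatMap-zk (m ∷ ks) (p ∷ ps) =
    trans (LP.length-++ (zk m)) (cong₂ _+_ (length-zk m p) (length-concatMap-zk ks ps))

  x∈concatMap-zk : (ks : List ℕ) → Any (2 ≤_) ks → x ∈ concatMap zk ks
  x∈concatMap-zk (suc (suc m) ∷ ks) (here (s≤s (s≤s _))) = here refl
  x∈concatMap-zk (suc zero ∷ ks) (here (s≤s ()))
  x∈concatMap-zk (m ∷ ks) (there p) = AnyP.++⁺ʳ (zk m) (x∈concatMap-zk ks p)

  y∈concatMap-zk : (ks : List ℕ) → ¬ (ks ≡ []) → y ∈ concatMap zk ks
  y∈concatMap-zk [] ne with () ← ne refl
  y∈concatMap-zk (m ∷ ks) ne = AnyP.++⁺ˡ (AnyP.++⁺ʳ (replicate (m ∸ 1) x) (here refl))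

  AdmMono⇒shape : (k : ℕ) (w : Word) → AdmMono k w → (length w ≡ k) × x ∈ w × y ∈ w
  AdmMono⇒shape k w (ks , ne , ks≥1 , Σks , ks≥2 , refl) =
    trans (length-concatMap-zk ks ks≥1) Σks , x∈concatMap-zk ks ks≥2 , y∈concatMap-zk ks ne

  -- the exponents k₁, k₂, … of w = z_{k₁} z_{k₂} ⋯, after c pending x's
  blocks : ℕ → Word → List ℕ
  blocks c [] = []
  blocks c (x ∷ w) = blocks (suc c) w
  blocks c (y ∷ w) = suc c ∷ blocks 0 w

  concatMap-zk-blocks : (c : ℕ) (w : Word) → concatMap zk (blocks c (w ++ y ∷ [])) ≡ replicate c x ++ w ++ y ∷ []
  concatMap-zk-blocks c [] = LP.++-identityʳ (replicate c x ++ y ∷ [])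
  concatMap-zk-blocks c (x ∷ w) = trans (concatMap-zk-blocks (suc c) w) (x-shift c)
    where
    x-shift : (c : ℕ) → replicate (suc c) x ++ w ++ y ∷ [] ≡ replicate c x ++ x ∷ w ++ y ∷ []
    x-shift zero = refl
    x-shift (suc c) = cong (x ∷_) (x-shift c)
  concatMap-zk-blocks c (y ∷ w) = trans (cong ((replicate c x ++ y ∷ []) ++_) (concatMap-zk-blocks 0 w))
    (LP.++-assoc (replicate c x) (y ∷ []) (w ++ y ∷ []))

  blocks-positive : (c : ℕ) (w : Word) → All (1 ≤_) (blocks c w)
  blocks-positive c [] = []
  blocks-positive c (x ∷ w) = blocks-positive (suc c) w
  blocks-positive c (y ∷ w) = s≤s z≤n ∷ blocks-positive 0 w

  sum-blocks : (c : ℕ) (w : Word) → sum (blocks c (w ++ y ∷ [])) ≡ c + length (w ++ y ∷ [])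
  sum-blocks c [] = trans (ℕP.+-identityʳ (suc c)) (ℕP.+-comm 1 c)
  sum-blocks c (x ∷ w) = trans (sum-blocks (suc c) w) (sym (ℕP.+-suc c _))
  sum-blocks c (y ∷ w) = trans (cong (suc c +_) (sum-blocks 0 w)) (sym (ℕP.+-suc c _))

  blocks-nonempty : (c : ℕ) (w : Word) → ¬ (blocks c (w ++ y ∷ []) ≡ [])
  blocks-nonempty c [] ()
  blocks-nonempty c (x ∷ w) = blocks-nonempty (suc c) w
  blocks-nonempty c (y ∷ w) ()

  blocks-≥2 : (c : ℕ) (w : Word) → (1 ≤ c ⊎ x ∈ w) → Any (2 ≤_) (blocks c (w ++ y ∷ []))
  blocks-≥2 (suc c) [] (inj₁ _) = here (s≤s (s≤s z≤n))
  blocks-≥2 c [] (inj₂ ())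
  blocks-≥2 c (x ∷ w) _ = blocks-≥2 (suc c) w (inj₁ (s≤s z≤n))
  blocks-≥2 (suc c) (y ∷ w) (inj₁ _) = here (s≤s (s≤s z≤n))
  blocks-≥2 c (y ∷ w) (inj₂ (there x∈w)) = there (blocks-≥2 0 w (inj₂ x∈w))

  AdmMono-∷ʳy : (w : Word) → x ∈ w → AdmMono (length (w ++ y ∷ [])) (w ++ y ∷ [])
  AdmMono-∷ʳy w x∈w = blocks 0 (w ++ y ∷ []) , blocks-nonempty 0 w , blocks-positive 0 (w ++ y ∷ [])
    , sum-blocks 0 w , blocks-≥2 0 w (inj₂ x∈w) , sym (concatMap-zk-blocks 0 w)

  expand⁻ : List Sym → List Word
  expand⁻ [] = []
  expand⁻ (sy ∷ u) = map (y ∷_) (expand⁻ u)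
  expand⁻ (sz ∷ u) = map (x ∷_) (expand u) ++ map (y ∷_) (expand⁻ u)

  ∑-expand : (u : List Sym) (f : Word → ℚ) → ∑ (expand u) f ≡ ∑ (expand⁻ u) f +ℚ f (replicate (length u) y)
  ∑-map-y∷-expand : (u : List Sym) (f : Word → ℚ) →
    ∑ (map (y ∷_) (expand u)) f ≡ ∑ (map (y ∷_) (expand⁻ u)) f +ℚ f (y ∷ replicate (length u) y)

  ∑-expand [] f = trans (ℚP.+-identityʳ (f [])) (sym (ℚP.+-identityˡ (f [])))
  ∑-expand (sy ∷ u) f = ∑-map-y∷-expand u f
  ∑-expand (sz ∷ u) f = begin
    ∑ (X ++ map (y ∷_) (expand u)) f
      ≡⟨ ∑-++ X (map (y ∷_) (expand u)) f ⟩
    ∑ X f +ℚ ∑ (map (y ∷_) (expand u)) f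
      ≡⟨ cong (∑ X f +ℚ_) (∑-map-y∷-expand u f) ⟩
    ∑ X f +ℚ (∑ (map (y ∷_) (expand⁻ u)) f +ℚ lastTerm)
      ≡⟨ sym (ℚP.+-assoc (∑ X f) _ lastTerm) ⟩
    ∑ X f +ℚ ∑ (map (y ∷_) (expand⁻ u)) f +ℚ lastTerm
      ≡⟨ cong (_+ℚ lastTerm) (sym (∑-++ X (map (y ∷_) (expand⁻ u)) f)) ⟩
    ∑ (X ++ map (y ∷_) (expand⁻ u)) f +ℚ lastTerm
      ∎
    where
    open ≡-Reasoning
    X : List Word
    X = map (x ∷_) (expand u)
    lastTerm : ℚ
    lastTerm = f (y ∷ replicate (length u) y)

  ∑-map-y∷-expand u f = begin
    ∑ (map (y ∷_) (expand u)) f                               ≡⟨ ∑-map (y ∷_) (expand u) f ⟩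
    ∑ (expand u) (λ w → f (y ∷ w))                            ≡⟨ ∑-expand u (λ w → f (y ∷ w)) ⟩
    ∑ (expand⁻ u) (λ w → f (y ∷ w)) +ℚ f (y ∷ replicate (length u) y)
      ≡⟨ cong (_+ℚ f (y ∷ replicate (length u) y)) (sym (∑-map (y ∷_) (expand⁻ u) f)) ⟩
    ∑ (map (y ∷_) (expand⁻ u)) f +ℚ f (y ∷ replicate (length u) y) ∎
    where open ≡-Reasoning

  EndsInY : ℕ → Word → Set
  EndsInY m w = Σ Word λ w′ → (w ≡ w′ ++ y ∷ []) × length w ≡ m

  EndsInY-∷ : (a : Letter) {m : ℕ} {w : Word} → EndsInY m w → EndsInY (suc m) (a ∷ w)
  EndsInY-∷ a (w′ , e , l) = a ∷ w′ , cong (a ∷_) e , cong suc l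

  expand-∷ʳsy : (c : List Sym) → All (EndsInY (length (c ++ sy ∷ []))) (expand (c ++ sy ∷ []))
  expand-∷ʳsy [] = ([] , refl , refl) ∷ []
  expand-∷ʳsy (sy ∷ c) = AllP.map⁺ (All.map (EndsInY-∷ y) (expand-∷ʳsy c))
  expand-∷ʳsy (sz ∷ c) =
    AllP.++⁺ (AllP.map⁺ (All.map (EndsInY-∷ x) (expand-∷ʳsy c))) (AllP.map⁺ (All.map (EndsInY-∷ y) (expand-∷ʳsy c)))

  AdmShape : ℕ → Word → Set
  AdmShape m w = Σ Word λ w′ → (w ≡ w′ ++ y ∷ []) × x ∈ w′ × length w ≡ m

  AdmShape-∷y : {m : ℕ} {w : Word} → AdmShape m w → AdmShape (suc m) (y ∷ w)
  AdmShape-∷y (w′ , e , x∈ , l) = y ∷ w′ , cong (y ∷_) e , there x∈ , cong suc l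

  AdmShape-x∷ : {m : ℕ} {w : Word} → EndsInY m w → AdmShape (suc m) (x ∷ w)
  AdmShape-x∷ (w′ , e , l) = x ∷ w′ , cong (x ∷_) e , here refl , cong suc l

  expand⁻-∷ʳsy : (c : List Sym) → All (AdmShape (length (c ++ sy ∷ []))) (expand⁻ (c ++ sy ∷ []))
  expand⁻-∷ʳsy [] = []
  expand⁻-∷ʳsy (sy ∷ c) = AllP.map⁺ (All.map AdmShape-∷y (expand⁻-∷ʳsy c))
  expand⁻-∷ʳsy (sz ∷ c) =
    AllP.++⁺ (AllP.map⁺ (All.map AdmShape-x∷ (expand-∷ʳsy c))) (AllP.map⁺ (All.map AdmShape-∷y (expand⁻-∷ʳsy c)))

  AdmShape⇒AdmMono : {m : ℕ} {w : Word} → AdmShape m w → AdmMono m w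
  AdmShape⇒AdmMono (w′ , refl , x∈ , refl) = AdmMono-∷ʳy w′ x∈

  preimage : List Sym → List Sym → Poly
  preimage a a₀ = map (λ w → (1ℚ , w)) (expand⁻ (a ++ sy ∷ [])) ++ map (λ w → (- 1ℚ , w)) (expand⁻ (a₀ ++ sy ∷ []))

  preimage-InHcheck : (k : ℕ) (a a₀ : List Sym) → length (a ++ sy ∷ []) ≡ k → length (a₀ ++ sy ∷ []) ≡ k →
    InHcheck k (preimage a a₀)
  preimage-InHcheck k a a₀ refl e = AllP.++⁺
    (AllP.map⁺ (All.map AdmShape⇒AdmMono (expand⁻-∷ʳsy a)))
    (AllP.map⁺ (All.map (λ p → subst (λ m → AdmMono m _) e (AdmShape⇒AdmMono p)) (expand⁻-∷ʳsy a₀)))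

module Coordinates where

  open import Defs
  open Sums
  open ChangeOfBasis using (lin)
  open import Data.Nat using (ℕ; zero; suc)
  open import Data.Rational using (ℚ; 0ℚ; 1ℚ; -_; _+_; _*_; 1/_; ≢-nonZero)
  import Data.Rational.Properties as ℚP
  open import Data.Rational.Solver using (module +-*-Solver)
  open import Data.List using (List; []; _∷_)
  open import Data.Vec using (Vec; lookup; replicate; zipWith) renaming ([] to []ᵥ; _∷_ to _∷ᵥ_; map to mapᵥ)
  open import Data.Fin using (Fin) renaming (zero to fz; suc to fs)
  import Data.Fin.Properties as FP
  open import Data.Product using (proj₁; proj₂)
  open import Relation.Nullary using (¬_)
  open import Relation.Binary.PropositionalEquality
  open +-*-Solver

  dot : {d : ℕ} → Vec ℚ d → (Fin d → ℚ) → ℚ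
  dot []ᵥ β = 0ℚ
  dot (c ∷ᵥ cs) β = c * β fz + dot cs (λ j → β (fs j))

  dot-cong : {d : ℕ} (c : Vec ℚ d) {β β′ : Fin d → ℚ} → (∀ j → β j ≡ β′ j) → dot c β ≡ dot c β′
  dot-cong []ᵥ e = refl
  dot-cong (c ∷ᵥ cs) e = cong₂ _+_ (cong (c *_) (e fz)) (dot-cong cs (λ j → e (fs j)))

  dot-* : {d : ℕ} (c : Vec ℚ d) (s : ℚ) (β : Fin d → ℚ) → dot c (λ j → s * β j) ≡ s * dot c β
  dot-* []ᵥ s β = sym (ℚP.*-zeroʳ s)
  dot-* (c ∷ᵥ cs) s β = trans (cong (c * (s * β fz) +_) (dot-* cs s (λ j → β (fs j))))
    (solve 4 (λ c s b r → c :* (s :* b) :+ s :* r := s :* (c :* b :+ r)) refl c s (β fz) (dot cs (λ j → β (fs j))))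

  dot-neg : {d : ℕ} (c : Vec ℚ d) (β : Fin d → ℚ) → dot c (λ j → - β j) ≡ - dot c β
  dot-neg []ᵥ β = refl
  dot-neg (c ∷ᵥ cs) β = trans (cong (c * - β fz +_) (dot-neg cs (λ j → β (fs j))))
    (solve 3 (λ c b r → c :* (:- b) :+ (:- r) := :- (c :* b :+ r)) refl c (β fz) (dot cs (λ j → β (fs j))))

  dot-zero : {d : ℕ} (c : Vec ℚ d) (β : Fin d → ℚ) → (∀ j → β j ≡ 0ℚ) → dot c β ≡ 0ℚ
  dot-zero []ᵥ β h = refl
  dot-zero (c ∷ᵥ cs) β h = trans (cong₂ (λ b r → c * b + r) (h fz) (dot-zero cs (λ j → β (fs j)) (λ j → h (fs j))))
    (trans (ℚP.+-identityʳ (c * 0ℚ)) (ℚP.*-zeroʳ c))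

  dot-single : {d : ℕ} (c : Vec ℚ d) (β : Fin d → ℚ) (i : Fin d) → (∀ j → ¬ (j ≡ i) → β j ≡ 0ℚ) →
    dot c β ≡ lookup c i * β i
  dot-single (c ∷ᵥ cs) β fz h =
    trans (cong (c * β fz +_) (dot-zero cs (λ j → β (fs j)) (λ j → h (fs j) (λ ())))) (ℚP.+-identityʳ _)
  dot-single (c ∷ᵥ cs) β (fs i) h =
    trans (cong₂ (λ b r → c * b + r) (h fz (λ ()))
                 (dot-single cs (λ j → β (fs j)) i (λ j ne → h (fs j) (λ e → ne (FP.suc-injective e)))))
      (trans (cong (_+ (lookup cs i * β (fs i))) (ℚP.*-zeroʳ c)) (ℚP.+-identityˡ _))

  unitᵛ : {d : ℕ} → Fin d → Vec ℚ d
  unitᵛ {suc d} fz = 1ℚ ∷ᵥ replicate d 0ℚ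
  unitᵛ {suc d} (fs i) = 0ℚ ∷ᵥ unitᵛ i

  ∑ᵛ : {A : Set} {d : ℕ} → List A → (A → Vec ℚ d) → Vec ℚ d
  ∑ᵛ {d = d} [] f = replicate d 0ℚ
  ∑ᵛ (a ∷ l) f = zipWith _+_ (f a) (∑ᵛ l f)

  dot-0ᵛ : (d : ℕ) (β : Fin d → ℚ) → dot (replicate d 0ℚ) β ≡ 0ℚ
  dot-0ᵛ zero β = refl
  dot-0ᵛ (suc d) β = trans (cong (0ℚ * β fz +_) (dot-0ᵛ d (λ j → β (fs j))))
    (trans (ℚP.+-identityʳ (0ℚ * β fz)) (ℚP.*-zeroˡ (β fz)))

  dot-+ᵛ : {d : ℕ} (a b : Vec ℚ d) (β : Fin d → ℚ) → dot (zipWith _+_ a b) β ≡ dot a β + dot b β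
  dot-+ᵛ []ᵥ []ᵥ β = refl
  dot-+ᵛ (a ∷ᵥ as) (b ∷ᵥ bs) β = trans (cong ((a + b) * β fz +_) (dot-+ᵛ as bs (λ j → β (fs j))))
    (solve 5 (λ a b x r s → (a :+ b) :* x :+ (r :+ s) := (a :* x :+ r) :+ (b :* x :+ s)) refl
      a b (β fz) (dot as (λ j → β (fs j))) (dot bs (λ j → β (fs j))))

  dot-*ᵛ : {d : ℕ} (s : ℚ) (a : Vec ℚ d) (β : Fin d → ℚ) → dot (mapᵥ (s *_) a) β ≡ s * dot a β
  dot-*ᵛ s []ᵥ β = sym (ℚP.*-zeroʳ s)
  dot-*ᵛ s (a ∷ᵥ as) β = trans (cong (s * a * β fz +_) (dot-*ᵛ s as (λ j → β (fs j))))
    (solve 4 (λ s a x r → s :* a :* x :+ s :* r := s :* (a :* x :+ r)) refl s a (β fz) (dot as (λ j → β (fs j))))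

  dot-unitᵛ : {d : ℕ} (i : Fin d) (β : Fin d → ℚ) → dot (unitᵛ i) β ≡ β i
  dot-unitᵛ {suc d} fz β = trans (cong (1ℚ * β fz +_) (dot-0ᵛ d (λ j → β (fs j))))
    (trans (ℚP.+-identityʳ (1ℚ * β fz)) (ℚP.*-identityˡ (β fz)))
  dot-unitᵛ {suc d} (fs i) β = trans (cong (0ℚ * β fz +_) (dot-unitᵛ i (λ j → β (fs j))))
    (trans (cong (_+ β (fs i)) (ℚP.*-zeroˡ (β fz))) (ℚP.+-identityˡ (β (fs i))))

  dot-∑ᵛ : {A : Set} {d : ℕ} (l : List A) (f : A → Vec ℚ d) (β : Fin d → ℚ) → dot (∑ᵛ l f) β ≡ ∑ l (λ a → dot (f a) β)
  dot-∑ᵛ {d = d} [] f β = dot-0ᵛ d β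
  dot-∑ᵛ (a ∷ l) f β = trans (dot-+ᵛ (f a) (∑ᵛ l f) β) (cong (dot (f a) β +_) (dot-∑ᵛ l f β))

  lin-lincomb : {d : ℕ} (g : Word → ℚ) (c : Vec ℚ d) (b : Vec Poly d) → lin g (lincomb c b) ≡ dot c (λ j → lin g (lookup b j))
  lin-lincomb g []ᵥ []ᵥ = refl
  lin-lincomb g (c ∷ᵥ cs) (b ∷ᵥ bs) = trans (∑-++ (scale c b) (lincomb cs bs) _)
    (cong₂ _+_ lin-scale (lin-lincomb g cs bs))
    where
    lin-scale : lin g (scale c b) ≡ c * lin g b
    lin-scale = trans (∑-map _ b _) (trans (∑-cong b (λ e → ℚP.*-assoc c (proj₁ e) (g (proj₂ e)))) (∑-* b c _))

  *-eq-0ˡ : (a b : ℚ) → a * b ≡ 0ℚ → ¬ (b ≡ 0ℚ) → a ≡ 0ℚ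
  *-eq-0ˡ a b e b≢0 = begin
    a                 ≡⟨ sym (ℚP.*-identityʳ a) ⟩
    a * 1ℚ            ≡⟨ cong (a *_) (sym (ℚP.*-inverseʳ b {{≢-nonZero b≢0}})) ⟩
    a * (b * b⁻¹)     ≡⟨ sym (ℚP.*-assoc a b b⁻¹) ⟩
    a * b * b⁻¹       ≡⟨ cong (_* b⁻¹) e ⟩
    0ℚ * b⁻¹          ≡⟨ ℚP.*-zeroˡ b⁻¹ ⟩
    0ℚ                ∎
    where
    open ≡-Reasoning
    b⁻¹ : ℚ
    b⁻¹ = 1/_ b {{≢-nonZero b≢0}}

module ImageBasis (n k′ : ℕ) where

  open import Defs
  open Sums
  open Lists
  open ChangeOfBasis
  open Rotations
  open RhoFormula
  open Orbits
  open Orbits.Representatives n k′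
  open Admissible
  open Coordinates
  open import Data.Nat using (ℕ; suc; _≤_; z≤n; s≤s) renaming (_+_ to _+ℕ_)
  import Data.Nat.Properties as ℕP
  open import Data.Rational using (ℚ; 0ℚ; 1ℚ; -_; _+_; _*_)
  import Data.Rational.Properties as ℚP
  open import Data.Rational.Solver using (module +-*-Solver)
  open import Data.List using (List; []; _∷_; _++_; map; length; take; replicate)
  import Data.List.Properties as LP
  open import Data.List.Membership.Propositional using (_∈_)
  open import Data.List.Relation.Unary.All using (All)
  import Data.List.Relation.Unary.All as All
  open import Data.List.Relation.Unary.Any using (Any; here; there)
  import Data.List.Relation.Unary.Any as Any
  import Data.List.Relation.Unary.Any.Properties as AnyP
  open import Data.Vec using (Vec; toList; lookup; tabulate) renaming (replicate to replicateᵥ; map to mapᵥ)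
  import Data.Vec.Properties as VP
  open import Data.Fin using (Fin)
  open import Data.Product using (Σ; _×_; _,_; proj₁; proj₂)
  open import Relation.Nullary using (¬_; yes; no)
  open import Relation.Binary.PropositionalEquality
  open +-*-Solver

  k : ℕ
  k = suc k′

  d : ℕ
  d = length basisWords

  preimageOf : List Sym → Poly
  preimageOf a = preimage a a₀

  basis : Vec Poly d
  basis = tabulate (λ i → ρ n (preimageOf (word i)))

  length-a∷ʳsy : (a : List Sym) → length a ≡ k′ → length (a ++ sy ∷ []) ≡ k
  length-a∷ʳsy a e = trans (length-∷ʳ a sy) (cong suc e)

  preimageOf-InHcheck : (a : List Sym) → length a ≡ k′ → InHcheck k (preimageOf a)
  preimageOf-InHcheck a e = preimage-InHcheck k a a₀ (length-a∷ʳsy a e) (length-a∷ʳsy a₀ (LP.length-replicate k′))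

  HasLength : Poly → Set
  HasLength P = All (λ e → length (proj₂ e) ≡ k) P

  InHcheck⇒HasLength : (P : Poly) → InHcheck k P → HasLength P
  InHcheck⇒HasLength P h = All.map (λ {e} a → proj₁ (AdmMono⇒shape k (proj₂ e) a)) h

  rotationSumᴾ : Poly → List Sym → ℚ
  rotationSumᴾ P V = ∑ P (λ e → proj₁ e * rotationSum n k (proj₂ e) V)

  ρCoeff-rotationSumᴾ : (P : Poly) → HasLength P → (V : List Sym) → suc (length V) ≡ k +ℕ n →
    ρCoeff n P V ≡ - rotationSumᴾ P V
  ρCoeff-rotationSumᴾ P hl V eV = trans (∑-congᴬ P hl (λ e ew → trans (cong (proj₁ e *_) (begin
      ρCore n (proj₂ e) (λ S → yzCoeff S V)             ≡⟨ ρCore-yzCoeff n (proj₂ e) V (trans eV (cong (_+ℕ n) (sym ew))) ⟩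
      - ∑< (length (proj₂ e)) (splitTerm n (proj₂ e) V) ≡⟨ cong (λ m → - ∑< m (splitTerm n (proj₂ e) V)) ew ⟩
      - ∑< k (splitTerm n (proj₂ e) V)                  ≡⟨ cong -_ (∑-splitTerm n k (proj₂ e) V eV) ⟩
      - rotationSum n k (proj₂ e) V                     ∎))
      (solve 2 (λ c t → c :* (:- t) := :- (c :* t)) refl (proj₁ e) (rotationSum n k (proj₂ e) V))))
    (∑-neg P _)
    where open ≡-Reasoning

  ρCoeff-length : (P : Poly) → HasLength P → (V : List Sym) → ¬ (suc (length V) ≡ k +ℕ n) → ρCoeff n P V ≡ 0ℚ
  ρCoeff-length P hl V ne = ∑-zeroᴬ P _ hl (λ e ew →
    trans (cong (proj₁ e *_) (ρCore-yzCoeff-length n (proj₂ e) V (λ e′ → ne (trans e′ (cong (_+ℕ n) ew)))))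
          (ℚP.*-zeroʳ (proj₁ e)))

  count : List Sym → List Sym → ℚ
  count V A = rotationCount (n +ℕ k) (sy ∷ V) A

  relCount : List Sym → List Sym → ℚ
  relCount V A = count V A + - count V (rep a₀)

  ∑-expand⁻-rotationSum : (u V : List Sym) → length u ≡ k → suc (length V) ≡ k +ℕ n →
    ∑ (expand⁻ u) (λ w → rotationSum n k w V) ≡ count V (u ++ zⁿ) + - rotationSum n k (replicate (length u) y) V
  ∑-expand⁻-rotationSum u V eu eV = begin
    ∑ (expand⁻ u) f                                 ≡⟨ solve 2 (λ s t → s := (s :+ t) :+ (:- t)) refl (∑ (expand⁻ u) f) t ⟩
    ∑ (expand⁻ u) f + t + - t                       ≡⟨ cong (_+ - t) (sym (∑-expand u f)) ⟩
    ∑ (expand u) f + - t                            ≡⟨ cong (_+ - t) (∑-expand-rotationSum n k u V eu eV) ⟩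
    count V (u ++ zⁿ) + - t                         ∎
    where
    open ≡-Reasoning
    f : Word → ℚ
    f w = rotationSum n k w V
    t : ℚ
    t = f (replicate (length u) y)

  rotationSumᴾ-preimageOf : (a : List Sym) → length a ≡ k′ → (V : List Sym) → suc (length V) ≡ k +ℕ n →
    rotationSumᴾ (preimageOf a) V ≡ relCount V (rep a)
  rotationSumᴾ-preimageOf a ea V eV = begin
    rotationSumᴾ (preimageOf a) V
      ≡⟨ ∑-++ (map (λ w → (1ℚ , w)) (expand⁻ (a ++ sy ∷ []))) (map (λ w → (- 1ℚ , w)) (expand⁻ (a₀ ++ sy ∷ []))) g ⟩
    ∑ (map (λ w → (1ℚ , w)) (expand⁻ (a ++ sy ∷ []))) g + ∑ (map (λ w → (- 1ℚ , w)) (expand⁻ (a₀ ++ sy ∷ []))) g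
      ≡⟨ cong₂ _+_ (trans (∑-map (λ w → (1ℚ , w)) (expand⁻ (a ++ sy ∷ [])) g) (∑-* (expand⁻ (a ++ sy ∷ [])) 1ℚ f))
                   (trans (∑-map (λ w → (- 1ℚ , w)) (expand⁻ (a₀ ++ sy ∷ [])) g) (∑-* (expand⁻ (a₀ ++ sy ∷ [])) (- 1ℚ) f)) ⟩
    1ℚ * ∑ (expand⁻ (a ++ sy ∷ [])) f + - 1ℚ * ∑ (expand⁻ (a₀ ++ sy ∷ [])) f
      ≡⟨ cong₂ (λ p q → 1ℚ * p + - 1ℚ * q) (part a ea) (part a₀ (LP.length-replicate k′)) ⟩
    1ℚ * (count V (rep a) + - t) + - 1ℚ * (count V (rep a₀) + - t)
      ≡⟨ solve 3 (λ p q t → con 1ℚ :* (p :+ (:- t)) :+ (:- con 1ℚ) :* (q :+ (:- t)) := p :+ (:- q)) refl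
           (count V (rep a)) (count V (rep a₀)) t ⟩
    relCount V (rep a)
      ∎
    where
    open ≡-Reasoning
    f : Word → ℚ
    f w = rotationSum n k w V
    g : ℚ × Word → ℚ
    g e = proj₁ e * f (proj₂ e)
    t : ℚ
    t = f (replicate k y)
    part : (b : List Sym) → length b ≡ k′ → ∑ (expand⁻ (b ++ sy ∷ [])) f ≡ count V (rep b) + - t
    part b eb = trans (∑-expand⁻-rotationSum (b ++ sy ∷ []) V (length-a∷ʳsy b eb) eV)
      (cong₂ (λ A m → count V A + - f (replicate m y)) (LP.++-assoc b (sy ∷ []) zⁿ) (length-a∷ʳsy b eb))

  length-zⁿ++ : (a : List Sym) → length a ≡ k′ → suc (length (zⁿ ++ a)) ≡ k +ℕ n
  length-zⁿ++ a e = cong suc (trans (LP.length-++ zⁿ) (trans (cong₂ _+ℕ_ (LP.length-replicate n) e) (ℕP.+-comm n k′)))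

  module Independence (i : Fin d) where

    a : List Sym
    a = word i

    V : List Sym
    V = zⁿ ++ a

    Y : List Sym
    Y = sy ∷ V

    length-Y : length Y ≡ L
    length-Y = trans (length-zⁿ++ a (proj₁ (word-props i))) (ℕP.+-comm k n)

    rotate-Y : rotate (suc n) Y ≡ rep a
    rotate-Y = rotate-∷-++ sy zⁿ a (LP.length-replicate n)

    Y~ : (b : List Sym) → length b ≡ k′ → (j : ℕ) → rotate j Y ≡ rep b → CycEq (toVec L Y) (repVec b)
    Y~ b eb j e = rotate⇒CycEq (toVec L Y) (repVec b) j (trans (cong (rotate j) (toList-toVec L Y length-Y)) (trans e (sym (toList-repVec b eb))))

    count-a₀ : count V (rep a₀) ≡ 0ℚ
    count-a₀ = rotationCount-zero L Y (rep a₀) (λ j _ e → 2≰1 (begin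
      2                          ≤⟨ s≤s (proj₂ (word-props i)) ⟩
      suc (#y a)                 ≡⟨ cong suc (sym (trans (#y-++ zⁿ a) (cong (_+ℕ #y a) (#y-zs n)))) ⟩
      #y Y                       ≡⟨ sym (#y-rotate (suc j) Y) ⟩
      #y (rotate (suc j) Y)      ≡⟨ cong #y e ⟩
      #y (rep a₀)                ≡⟨ trans (#y-rep a₀) (cong suc (#y-zs k′)) ⟩
      1                          ∎))
      where
      open ℕP.≤-Reasoning
      2≰1 : ¬ (2 ≤ 1)
      2≰1 (s≤s ())

    count-other : (j : Fin d) → ¬ (j ≡ i) → count V (rep (word j)) ≡ 0ℚ
    count-other j ne = rotationCount-zero L Y (rep (word j)) (λ t _ e → words-distinct i j (λ e′ → ne (sym e′))
      (CycEq-trans _ _ _ (CycEq-sym _ _ (Y~ a (proj₁ (word-props i)) (suc n) rotate-Y))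
                         (Y~ (word j) (proj₁ (word-props j)) (suc t) e)))

    count-self : ¬ (count V (rep a) ≡ 0ℚ)
    count-self = rotationCount-nonzero L Y (rep a) n (ℕP.m<m+n n (s≤s z≤n)) rotate-Y

    f : Word → ℚ
    f u = yzCoeff u (sz ∷ V ++ sy ∷ [])

    lin-f-basis : (j : Fin d) → lin f (lookup basis j) ≡ - relCount V (rep (word j))
    lin-f-basis j = begin
      lin f (lookup basis j)                           ≡⟨ cong (lin f) (VP.lookup∘tabulate _ j) ⟩
      lin f (ρ n (preimageOf (word j)))
        ≡⟨ lin-ρ-frame n f 1ℚ V (λ S → cong (1ℚ *_) (trans (yzCoeff-∷ʳ S y V sy) (ℚP.*-identityʳ (yzCoeff S V))))
             (preimageOf (word j)) ⟩
      1ℚ * ρCoeff n (preimageOf (word j)) V             ≡⟨ ℚP.*-identityˡ _ ⟩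
      ρCoeff n (preimageOf (word j)) V
        ≡⟨ ρCoeff-rotationSumᴾ _ (InHcheck⇒HasLength _ (preimageOf-InHcheck (word j) (proj₁ (word-props j)))) V
             (length-zⁿ++ a (proj₁ (word-props i))) ⟩
      - rotationSumᴾ (preimageOf (word j)) V
        ≡⟨ cong -_ (rotationSumᴾ-preimageOf (word j) (proj₁ (word-props j)) V (length-zⁿ++ a (proj₁ (word-props i)))) ⟩
      - relCount V (rep (word j))                      ∎
      where open ≡-Reasoning

    relCount-a₀ : (A : List Sym) → relCount V A ≡ count V A
    relCount-a₀ A = trans (cong (λ c → count V A + - c) count-a₀) (ℚP.+-identityʳ (count V A))

    coordinate-zero : (c : Vec ℚ d) → lincomb c basis ≈ₚ zeroP → lookup c i ≡ 0ℚ
    coordinate-zero c hyp = *-eq-0ˡ (lookup c i) (- relCount V (rep a)) (begin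
      lookup c i * - relCount V (rep a)
        ≡⟨ sym (dot-single c _ i (λ j ne → cong -_ (trans (relCount-a₀ (rep (word j))) (count-other j ne)))) ⟩
      dot c (λ j → - relCount V (rep (word j)))        ≡⟨ sym (dot-cong c lin-f-basis) ⟩
      dot c (λ j → lin f (lookup basis j))             ≡⟨ sym (lin-lincomb f c basis) ⟩
      lin f (lincomb c basis)
        ≡⟨ lin-resp-≈ (length (sz ∷ V ++ sy ∷ [])) f (λ u ne → yzCoeff-length u _ ne) (lincomb c basis) zeroP hyp ⟩
      0ℚ                                               ∎)
      (λ z → count-self (trans (sym (relCount-a₀ (rep a))) (ℚP.neg-injective {q = 0ℚ} z)))
      where open ≡-Reasoning

  count-rotate : (V A : List Sym) → suc (length V) ≡ k +ℕ n → length A ≡ L → (j : ℕ) → count V (rotate j A) ≡ count V A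
  count-rotate V A eV eA j = rotationCount-rotateʳ (n +ℕ k) j (sy ∷ V) A (trans eV (ℕP.+-comm k n)) eA

  uVec : List Sym → Vec Sym L
  uVec u = toVec L (u ++ zⁿ)

  toList-uVec : (u : List Sym) → length u ≡ k → toList (uVec u) ≡ u ++ zⁿ
  toList-uVec u e = toList-toVec L (u ++ zⁿ) (trans (LP.length-++ u) (trans (cong₂ _+ℕ_ e (LP.length-replicate n)) (ℕP.+-comm k n)))

  InX-uVec : (u : List Sym) → length u ≡ k → InX L n (uVec u)
  InX-uVec u e = k , take-zs⇒lookup (rot k (uVec u)) n (begin
    take n (toList (rot k (uVec u)))      ≡⟨ cong (take n) (toList-rot k (uVec u)) ⟩
    take n (rotate k (toList (uVec u)))   ≡⟨ cong (λ l → take n (rotate k l)) (toList-uVec u e) ⟩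
    take n (rotate k (u ++ zⁿ))           ≡⟨ cong (take n) (rotate-++-exact u zⁿ e) ⟩
    take n (zⁿ ++ u)                      ≡⟨ take-++-exact zⁿ u (LP.length-replicate n) ⟩
    zⁿ                                    ∎)
    where open ≡-Reasoning

  -- the coordinates of the class of u zⁿ; those of z^L and of a₀ y zⁿ contribute nothing
  classCoord : (T : Vec Sym L) → Any (CycEq T) representatives → Vec ℚ d
  classCoord T (here _) = replicateᵥ d 0ℚ
  classCoord T (there (here _)) = replicateᵥ d 0ℚ
  classCoord T (there (there p)) = unitᵛ (Any.index (AnyP.map⁻ p))

  coord : List Sym → Vec ℚ d
  coord u with length u ℕP.≟ k
  ... | yes e = classCoord (uVec u) (representatives-cover (uVec u) (InX-uVec u e))
  ... | no _ = replicateᵥ d 0ℚ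

  count-CycEq : (V : List Sym) → suc (length V) ≡ k +ℕ n → (u : List Sym) → length u ≡ k → (A : List Sym) →
    CycEq (uVec u) (toVec L A) → length A ≡ L → count V A ≡ count V (u ++ zⁿ)
  count-CycEq V eV u eu A c eA with CycEq⇒rotate (uVec u) (toVec L A) c
  ... | j , e = begin
    count V A
      ≡⟨ cong (count V) (sym (trans (sym (cong (rotate j) (toList-uVec u eu))) (trans e (toList-toVec L A eA)))) ⟩
    count V (rotate j (u ++ zⁿ))             ≡⟨ count-rotate V (u ++ zⁿ) eV length-u++zⁿ j ⟩
    count V (u ++ zⁿ)                        ∎
    where
    open ≡-Reasoning
    length-u++zⁿ : length (u ++ zⁿ) ≡ L
    length-u++zⁿ = trans (sym (cong length (toList-uVec u eu))) (VP.length-toList (uVec u))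

  classCoord-spec : (V : List Sym) → suc (length V) ≡ k +ℕ n → (w : Word) → y ∈ w → (u : List Sym) → length u ≡ k →
    (c : Any (CycEq (uVec u)) representatives) →
    yzCoeff w u * dot (classCoord (uVec u) c) (λ j → relCount V (rep (word j))) ≡ yzCoeff w u * relCount V (u ++ zⁿ)
  classCoord-spec V eV w y∈w u eu (here c) =
    trans (cong (_* dot (replicateᵥ d 0ℚ) β) w-u≡0) (trans (ℚP.*-zeroˡ (dot (replicateᵥ d 0ℚ) β))
      (sym (trans (cong (_* relCount V (u ++ zⁿ)) w-u≡0) (ℚP.*-zeroˡ (relCount V (u ++ zⁿ))))))
    where
    β : Fin d → ℚ
    β j = relCount V (rep (word j))
    #y-u : #y u ≡ 0
    #y-u = ℕP.m+n≡0⇒m≡0 (#y u) (begin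
      #y u +ℕ #y zⁿ          ≡⟨ sym (#y-++ u zⁿ) ⟩
      #y (u ++ zⁿ)           ≡⟨ cong #y (sym (toList-uVec u eu)) ⟩
      #y (toList (uVec u))   ≡⟨ CycEq-#y (uVec u) zVec c ⟩
      #y (toList zVec)       ≡⟨ #y-zVec ⟩
      0                      ∎)
      where open ≡-Reasoning
    w-u≡0 : yzCoeff w u ≡ 0ℚ
    w-u≡0 = trans (cong (yzCoeff w) (trans (#y≡0 u #y-u) (cong (λ m → replicate m sz) eu))) (yzCoeff-zs-y∈ k w y∈w)
  classCoord-spec V eV w y∈w u eu (there (here c)) = cong (yzCoeff w u *_) (trans (dot-0ᵛ d _) (sym (begin
    count V (u ++ zⁿ) + - count V (rep a₀)       ≡⟨ cong (λ t → count V (u ++ zⁿ) + - t) (count-CycEq V eV u eu (rep a₀) c eA₀) ⟩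
    count V (u ++ zⁿ) + - count V (u ++ zⁿ)      ≡⟨ ℚP.+-inverseʳ (count V (u ++ zⁿ)) ⟩
    0ℚ                                           ∎)))
    where
    open ≡-Reasoning
    eA₀ : length (rep a₀) ≡ L
    eA₀ = length-rep a₀ (LP.length-replicate k′)
  classCoord-spec V eV w y∈w u eu (there (there p)) = cong (yzCoeff w u *_) (begin
    dot (unitᵛ i) (λ j → relCount V (rep (word j)))   ≡⟨ dot-unitᵛ i _ ⟩
    relCount V (rep (word i))                         ≡⟨ cong (λ t → t + - count V (rep a₀))
                                                           (count-CycEq V eV u eu (rep (word i)) (AnyP.lookup-index p′)
                                                              (length-rep (word i) (proj₁ (word-props i)))) ⟩
    relCount V (u ++ zⁿ)                              ∎)
    where
    open ≡-Reasoning
    p′ : Any (λ b → CycEq (uVec u) (repVec b)) basisWords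
    p′ = AnyP.map⁻ p
    i : Fin d
    i = Any.index p′

  coord-spec : (V : List Sym) → suc (length V) ≡ k +ℕ n → (w : Word) → y ∈ w → (u : List Sym) → length u ≡ k →
    yzCoeff w u * dot (coord u) (λ j → relCount V (rep (word j))) ≡ yzCoeff w u * relCount V (u ++ zⁿ)
  coord-spec V eV w y∈w u eu with length u ℕP.≟ k
  ... | yes e = classCoord-spec V eV w y∈w u eu (representatives-cover (uVec u) (InX-uVec u e))
  ... | no ne with () ← ne eu

  -- x ∈ w kills the a₀ term: the yz-coefficients of w sum to 0
  rotationSum-coords : (V : List Sym) → suc (length V) ≡ k +ℕ n → (w : Word) → length w ≡ k → x ∈ w → y ∈ w →
    rotationSum n k w V ≡ ∑ (allSyms k) (λ u → yzCoeff w u * dot (coord u) (λ j → relCount V (rep (word j))))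
  rotationSum-coords V eV w ew x∈w y∈w = begin
    rotationSum n k w V
      ≡⟨ rotationSum-via-rotationCount n k w V ew eV ⟩
    ∑ (allSyms k) (λ u → yzCoeff w u * count V (u ++ zⁿ))
      ≡⟨ sym (ℚP.+-identityʳ _) ⟩
    ∑ (allSyms k) (λ u → yzCoeff w u * count V (u ++ zⁿ)) + 0ℚ
      ≡⟨ cong (∑ (allSyms k) (λ u → yzCoeff w u * count V (u ++ zⁿ)) +_) (sym a₀-terms) ⟩
    ∑ (allSyms k) (λ u → yzCoeff w u * count V (u ++ zⁿ)) + ∑ (allSyms k) (λ u → yzCoeff w u * - count V (rep a₀))
      ≡⟨ sym (∑-+ (allSyms k) _ _) ⟩
    ∑ (allSyms k) (λ u → yzCoeff w u * count V (u ++ zⁿ) + yzCoeff w u * - count V (rep a₀))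
      ≡⟨ ∑-congᴬ (allSyms k) (allSyms-length k) (λ u eu →
           trans (sym (ℚP.*-distribˡ-+ (yzCoeff w u) _ _)) (sym (coord-spec V eV w y∈w u eu))) ⟩
    ∑ (allSyms k) (λ u → yzCoeff w u * dot (coord u) (λ j → relCount V (rep (word j))))
      ∎
    where
    open ≡-Reasoning
    a₀-terms : ∑ (allSyms k) (λ u → yzCoeff w u * - count V (rep a₀)) ≡ 0ℚ
    a₀-terms = begin
      ∑ (allSyms k) (λ u → yzCoeff w u * - count V (rep a₀))
        ≡⟨ ∑-cong (allSyms k) (λ u → ℚP.*-comm (yzCoeff w u) _) ⟩
      ∑ (allSyms k) (λ u → - count V (rep a₀) * yzCoeff w u)
        ≡⟨ ∑-* (allSyms k) (- count V (rep a₀)) (yzCoeff w) ⟩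
      - count V (rep a₀) * ∑ (allSyms k) (yzCoeff w)
        ≡⟨ cong (- count V (rep a₀) *_) (∑-yzCoeff-x∈ k w x∈w) ⟩
      - count V (rep a₀) * 0ℚ
        ≡⟨ ℚP.*-zeroʳ (- count V (rep a₀)) ⟩
      0ℚ
        ∎

  coords : Poly → Vec ℚ d
  coords P = ∑ᵛ P (λ e → mapᵥ (proj₁ e *_) (∑ᵛ (allSyms k) (λ u → mapᵥ (yzCoeff (proj₂ e) u *_) (coord u))))

  rotationSumᴾ-coords : (P : Poly) → InHcheck k P → (V : List Sym) → suc (length V) ≡ k +ℕ n →
    rotationSumᴾ P V ≡ dot (coords P) (λ j → rotationSumᴾ (preimageOf (word j)) V)
  rotationSumᴾ-coords P hP V eV = sym (begin
    dot (coords P) (λ j → rotationSumᴾ (preimageOf (word j)) V)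
      ≡⟨ dot-cong (coords P) (λ j → rotationSumᴾ-preimageOf (word j) (proj₁ (word-props j)) V eV) ⟩
    dot (coords P) β
      ≡⟨ dot-∑ᵛ P _ β ⟩
    ∑ P (λ e → dot (mapᵥ (proj₁ e *_) (∑ᵛ (allSyms k) (λ u → mapᵥ (yzCoeff (proj₂ e) u *_) (coord u)))) β)
      ≡⟨ ∑-congᴬ P hP (λ e adm → trans (dot-*ᵛ (proj₁ e) (∑ᵛ (allSyms k) (λ u → mapᵥ (yzCoeff (proj₂ e) u *_) (coord u))) β)
                                      (cong (proj₁ e *_) (perWord (proj₂ e) adm))) ⟩
    rotationSumᴾ P V
      ∎)
    where
    open ≡-Reasoning
    β : Fin d → ℚ
    β j = relCount V (rep (word j))
    perWord : (w : Word) → AdmMono k w → dot (∑ᵛ (allSyms k) (λ u → mapᵥ (yzCoeff w u *_) (coord u))) β ≡ rotationSum n k w V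
    perWord w adm with AdmMono⇒shape k w adm
    ... | ew , x∈w , y∈w = begin
      dot (∑ᵛ (allSyms k) (λ u → mapᵥ (yzCoeff w u *_) (coord u))) β
        ≡⟨ dot-∑ᵛ (allSyms k) _ β ⟩
      ∑ (allSyms k) (λ u → dot (mapᵥ (yzCoeff w u *_) (coord u)) β)
        ≡⟨ ∑-cong (allSyms k) (λ u → dot-*ᵛ (yzCoeff w u) (coord u) β) ⟩
      ∑ (allSyms k) (λ u → yzCoeff w u * dot (coord u) β)
        ≡⟨ sym (rotationSum-coords V eV w ew x∈w y∈w) ⟩
      rotationSum n k w V
        ∎

  ρCoeff-coords : (P : Poly) → InHcheck k P → (V : List Sym) →
    ρCoeff n P V ≡ dot (coords P) (λ j → ρCoeff n (preimageOf (word j)) V)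
  ρCoeff-coords P hP V with suc (length V) ℕP.≟ k +ℕ n
  ... | yes eV = begin
    ρCoeff n P V                                               ≡⟨ ρCoeff-rotationSumᴾ P (InHcheck⇒HasLength P hP) V eV ⟩
    - rotationSumᴾ P V                                         ≡⟨ cong -_ (rotationSumᴾ-coords P hP V eV) ⟩
    - dot (coords P) β                                         ≡⟨ sym (dot-neg (coords P) β) ⟩
    dot (coords P) (λ j → - β j)                               ≡⟨ dot-cong (coords P) (λ j → sym (ρCoeff-rotationSumᴾ _ (hl j) V eV)) ⟩
    dot (coords P) (λ j → ρCoeff n (preimageOf (word j)) V)    ∎
    where
    open ≡-Reasoning
    β : Fin d → ℚ
    β j = rotationSumᴾ (preimageOf (word j)) V
    hl : (j : Fin d) → HasLength (preimageOf (word j))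
    hl j = InHcheck⇒HasLength _ (preimageOf-InHcheck (word j) (proj₁ (word-props j)))
  ... | no ne = trans (ρCoeff-length P (InHcheck⇒HasLength P hP) V ne)
    (sym (dot-zero (coords P) _ (λ j → ρCoeff-length _ (InHcheck⇒HasLength _ (preimageOf-InHcheck (word j) (proj₁ (word-props j)))) V ne)))

  spans : ∀ q → ImRho n k q → Σ (Vec ℚ d) λ c → q ≈ₚ lincomb c basis
  spans q (P , hP , q≈ρP) = coords P , λ w → trans (q≈ρP w) (≈-from-yzCoeffs (ρ n P) (lincomb (coords P) basis) agree w)
    where
    agree : ∀ T → lin (λ u → yzCoeff u T) (ρ n P) ≡ lin (λ u → yzCoeff u T) (lincomb (coords P) basis)
    agree T with yzCoeff-frame T
    ... | κ , V , frame = begin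
      lin f (ρ n P)                                              ≡⟨ lin-ρ-frame n f κ V frame P ⟩
      κ * ρCoeff n P V                                           ≡⟨ cong (κ *_) (ρCoeff-coords P hP V) ⟩
      κ * dot (coords P) (λ j → ρCoeff n (preimageOf (word j)) V) ≡⟨ sym (dot-* (coords P) κ _) ⟩
      dot (coords P) (λ j → κ * ρCoeff n (preimageOf (word j)) V) ≡⟨ dot-cong (coords P) (λ j → sym (lin-basis j)) ⟩
      dot (coords P) (λ j → lin f (lookup basis j))              ≡⟨ sym (lin-lincomb f (coords P) basis) ⟩
      lin f (lincomb (coords P) basis)                           ∎
      where
      open ≡-Reasoning
      f : Word → ℚ
      f u = yzCoeff u T
      lin-basis : (j : Fin d) → lin f (lookup basis j) ≡ κ * ρCoeff n (preimageOf (word j)) V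
      lin-basis j = trans (cong (lin f) (VP.lookup∘tabulate _ j)) (lin-ρ-frame n f κ V frame (preimageOf (word j)))

  hasDim : HasDim (ImRho n k) d
  hasDim = basis
    , (λ i → preimageOf (word i) , preimageOf-InHcheck (word i) (proj₁ (word-props i))
           , λ w → cong (λ P → coeff P w) (VP.lookup∘tabulate _ i))
    , (λ c hyp i → Independence.coordinate-zero i c hyp)
    , spans

open import Defs
open import Data.Nat using (suc; _+_; _≤_)
open import Data.Nat.Properties using (+-comm)
open import Data.Product using (Σ; _×_; _,_)
open import Relation.Binary.PropositionalEquality using (_≡_)

proposition5p9 : (n k : ℕ) → 1 ≤ k →
    Σ ℕ λ m → Σ ℕ λ d → NumY (n + k) n m × HasDim (ImRho n k) d × (d + 2 ≡ m)
proposition5p9 n (suc k′) _ = suc (suc d) , d , numY , hasDim , +-comm d 2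
  where
  open Orbits.Representatives n k′ using (numY)
  open ImageBasis n k′ using (d; hasDim)
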